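{- Let $p$ be an odd prime and $x$ a $p$-adic integer with $m:=\langle x\rangle_p\le (p-1)/2$, and put $t=(x-m)/p$. Then for integers $k$: if $0\le k\le m$, $$\binom{x}{k}\binom{x+k}{k}\equiv\binom{m}{k}\binom{m+k}{k}\bigl(1+ptH_{m+k}-ptH_{m-k}\bigr)\pmod{p^2};$$ if $p-m\le k\le p-1$, $$\binom{x}{k}\binom{x+k}{k}\equiv\frac{(-1)^m p^2t(t+1)}{k(k-m)\binom{m}{p-k}\binom{k}{m}}\pmod{p^3}.$$ Moreover, if $m<(p-1)/2$ and $m+1\le k\le p-1-m$, then $$\binom{x}{k}\binom{x+k}{k}\equiv\frac{(-1)^{m+k+1}pt\binom{m+k}{k}}{(k-m)\binom{k}{m}}\bigl(1+ptH_{m+k}-ptH_{k-m-1}\bigr)\pmod{p^3}.$$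
   Context: For a $p$-adic integer $x$ and a nonnegative integer $k$, $\binom{x}{k}=x(x-1)\cdots(x-k+1)/k!$. $\langle x\rangle_p$ is the least nonnegative residue of $x$ modulo $p$ (so $t=(x-m)/p$ is a $p$-adic integer). $H_n=\sum_{i=1}^n 1/i$ is the $n$th harmonic number ($H_0=0$). Congruences modulo $p^r$ between $p$-adic numbers mean the difference lies in $p^r\mathbb{Z}_p$. -}

module Defs where

open import Data.Nat as ℕ using (ℕ; zero; suc)
open import Data.Integer as ℤ using (ℤ; +_)
import Data.Integer.Divisibility as ℤDiv
import Data.Nat.Divisibility as ℕDiv
open import Data.Rational as ℚ using (ℚ; 0ℚ; 1ℚ; ↥_; ↧ₙ_)
open import Data.Rational.Properties using (_≟_)
open import Data.Product using (∃; _×_)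
open import Relation.Nullary using (¬_; yes; no)

ℕ→ℚ : ℕ → ℚ
ℕ→ℚ n = (+ n) ℚ./ 1

ℤ→ℚ : ℤ → ℚ
ℤ→ℚ z = z ℚ./ 1

-- Total division on ℚ (division by 0 returns 0; only ever used with nonzero divisors)
_÷'_ : ℚ → ℚ → ℚ
a ÷' b with b ≟ 0ℚ
... | yes _ = 0ℚ
... | no b≢0 = ℚ._÷_ a b {{ℚ.≢-nonZero b≢0}}

binomQ : ℚ → ℕ → ℚ
binomQ x zero = 1ℚ
binomQ x (suc k) = (binomQ x k ℚ.* (x ℚ.- ℕ→ℚ k)) ÷' ℕ→ℚ (suc k)

H : ℕ → ℚ
H zero = 0ℚ
H (suc n) = H n ℚ.+ (1ℚ ÷' ℕ→ℚ (suc n))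

negOnePow : ℕ → ℚ
negOnePow zero = 1ℚ
negOnePow (suc n) = ℚ.- negOnePow n

-- Congruence modulo p^r of rational numbers in ℤ_(p) ⊂ ℤ_p:
-- a ≡ b (mod p^r)  iff  a - b ∈ p^r ℤ_(p), i.e. in lowest terms
-- p^r divides the numerator and p does not divide the denominator.
QCong : ℕ → ℕ → ℚ → ℚ → Set
QCong p r a b = ((+ (p ℕ.^ r)) ℤDiv.∣ (↥ (a ℚ.- b))) × ¬ (p ℕDiv.∣ (↧ₙ (a ℚ.- b)))

-- p-adic integers, as compatible sequences of integer approximations:
-- approx (suc n) ≡ approx n (mod p^n); x is the p-adic limit of approx n.
record ℤₚ (p : ℕ) : Set where
  field
    approx : ℕ → ℤ
    coh    : ∀ n → (+ (p ℕ.^ n)) ℤDiv.∣ (approx (suc n) ℤ.- approx n)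
open ℤₚ public

resid : {p : ℕ} → ℤₚ p → ℕ
resid {zero} x = 0
resid {suc q} x = approx x 1 ℤ.%ℕ suc q

-- Congruence modulo p^r between the p-adic numbers f(x) and g(x), where
-- f, g are (continuous, p-integral) expressions in the variable x, given as
-- functions on ℚ: f(x) - g(x) ∈ p^r ℤ_p iff the congruence holds at all
-- sufficiently good integer approximations of x (the set p^r ℤ_p being open).
PCong : {p : ℕ} → ℤₚ p → ℕ → (ℚ → ℚ) → (ℚ → ℚ) → Set
PCong {p} x r f g =
  ∃ λ N → ∀ n → N ℕ.≤ n → QCong p r (f (ℤ→ℚ (approx x n))) (g (ℤ→ℚ (approx x n)))

{-# OPTIONS --safe #-}
-- Write x = m + p t.  Multiplied by k!², binom(x,k) binom(x+k,k) is the product of the falling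
-- factorials x↓k = x(x-1)⋯(x-k+1) and (x+k)↓k.  For c < p all factors of (c + p t)↓n are units,
-- so (c + p t)↓n ≡ c(c-1)⋯(c-n+1)·(1 + p t (H_c - H_{c-n})) and (p t - 1)↓n ≡ (-1)^n n! (1 - p t H_n)
-- modulo p².  For k ≤ m this is the first congruence.  For k > m the factor x - m = p t splits off
-- x↓k, leaving (p t - 1)↓(k-m-1)·(m + p t)↓m, which gives the third congruence modulo p³.  For
-- k ≥ p - m moreover x + k = (m + k - p) + p (t + 1), so (x+k)↓k loses the factor p (t + 1) as well and
-- only the remaining units modulo p matter; they are matched with the closed form through
-- a! (p-1-a)! ≡ (-1)^a (p-1)! (mod p) for a = m and a = k - 1, the sign needing p odd.
module Submission where

open import Defs
open import Level using (0ℓ)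
open import Data.Nat as ℕ using (ℕ; zero; suc; _∸_; _≤_; _<_; z≤n; s≤s; _!; _^_)
open import Data.Nat.Primality using (Prime; euclidsLemma; prime⇒nonTrivial; prime⇒nonZero; prime⇒irreducible)
import Data.Nat.Properties as ℕP
open import Data.Nat.Divisibility as ℕD using (_∣_; divides)
open import Data.Nat.DivMod using (m/n*n≡m; m/n*n≤m; m≡m%n+[m/n]*n; m%n<n)
open import Data.Nat.Combinatorics using (_C_; nCk≡n!/k![n-k]!; k![n∸k]!∣n!)
open import Data.Nat.Combinatorics.Base using (_P′_)
open import Data.Nat.Combinatorics.Specification using (nP′k≡n!/[n∸k]!; [n∸k]!k!∣n!; nP′n≡n!)
import Data.Nat.Tactic.RingSolver as ℕSolver
import Data.Integer.Tactic.RingSolver as ℤSolver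
open import Data.Integer as ℤ using (ℤ; +_)
import Data.Integer.Properties as ℤP
import Data.Integer.DivMod as ℤDivMod
import Data.Integer.Divisibility.Signed as ℤDivisibility
open import Data.Rational as ℚ using (ℚ; 0ℚ; 1ℚ; mkℚ; ↥_; ↧ₙ_; _+_; _*_; _-_; -_)
open import Data.Rational.Properties as ℚP using (_≟_)
import Data.Rational.Unnormalised as ℚᵘ
import Data.Nat.Coprimality as Coprime
open import Data.Product using (Σ; _×_; _,_; proj₁; proj₂)
open import Data.Sum using (inj₁; inj₂)
open import Data.Empty using (⊥-elim)
open import Relation.Nullary using (¬_; yes; no)
open import Relation.Nullary.Decidable using (dec⇒maybe)
open import Relation.Binary.PropositionalEquality
open import Relation.Binary.Bundles using (Preorder)
import Relation.Binary.Reasoning.Preorder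
open import Tactic.RingSolver using (solve-∀)
open import Tactic.RingSolver.Core.AlmostCommutativeRing using (AlmostCommutativeRing; fromCommutativeRing)

ℚ-ring : AlmostCommutativeRing 0ℓ 0ℓ
ℚ-ring = fromCommutativeRing ℚP.+-*-commutativeRing (λ x → dec⇒maybe (0ℚ ≟ x))

ℤ→ℚ≡mkℚ : ∀ z → ℤ→ℚ z ≡ mkℚ z 0 (Coprime.sym (Coprime.1-coprimeTo ℤ.∣ z ∣))
ℤ→ℚ≡mkℚ z = ℚP.↥p/↧p≡p (mkℚ z 0 (Coprime.sym (Coprime.1-coprimeTo ℤ.∣ z ∣)))

↥-ℤ→ℚ : ∀ z → ↥ (ℤ→ℚ z) ≡ z
↥-ℤ→ℚ z = cong ↥_ (ℤ→ℚ≡mkℚ z)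

ℤ→ℚ-+ : ∀ a b → ℤ→ℚ (a ℤ.+ b) ≡ ℤ→ℚ a + ℤ→ℚ b
ℤ→ℚ-+ a b rewrite ℤ→ℚ≡mkℚ a | ℤ→ℚ≡mkℚ b =
  cong (ℚ._/ 1) (sym (cong₂ ℤ._+_ (ℤP.*-identityʳ a) (ℤP.*-identityʳ b)))

ℤ→ℚ-* : ∀ a b → ℤ→ℚ (a ℤ.* b) ≡ ℤ→ℚ a * ℤ→ℚ b
ℤ→ℚ-* a b rewrite ℤ→ℚ≡mkℚ a | ℤ→ℚ≡mkℚ b = refl

ℕ→ℚ-+ : ∀ a b → ℕ→ℚ (a ℕ.+ b) ≡ ℕ→ℚ a + ℕ→ℚ b
ℕ→ℚ-+ a b = ℤ→ℚ-+ (+ a) (+ b)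

ℕ→ℚ-* : ∀ a b → ℕ→ℚ (a ℕ.* b) ≡ ℕ→ℚ a * ℕ→ℚ b
ℕ→ℚ-* a b = trans (cong ℤ→ℚ (ℤP.pos-* a b)) (ℤ→ℚ-* (+ a) (+ b))

ℕ→ℚ-∸ : ∀ {a b} → b ≤ a → ℕ→ℚ (a ∸ b) ≡ ℕ→ℚ a - ℕ→ℚ b
ℕ→ℚ-∸ {a} {b} b≤a = begin
  ℕ→ℚ (a ∸ b)                    ≡⟨ x≡x+y-y (ℕ→ℚ (a ∸ b)) (ℕ→ℚ b) ⟩
  (ℕ→ℚ (a ∸ b) + ℕ→ℚ b) - ℕ→ℚ b  ≡⟨ cong (_- ℕ→ℚ b) (sym (ℕ→ℚ-+ (a ∸ b) b)) ⟩
  ℕ→ℚ (a ∸ b ℕ.+ b) - ℕ→ℚ b      ≡⟨ cong (λ z → ℕ→ℚ z - ℕ→ℚ b) (ℕP.m∸n+n≡m b≤a) ⟩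
  ℕ→ℚ a - ℕ→ℚ b                  ∎
  where
  open ≡-Reasoning
  x≡x+y-y : ∀ x y → x ≡ (x + y) - y
  x≡x+y-y = solve-∀ ℚ-ring

+-shift : ∀ m k u → ℕ→ℚ m + u + ℕ→ℚ k ≡ ℕ→ℚ (m ℕ.+ k) + u
+-shift m k u = trans (swap (ℕ→ℚ m) u (ℕ→ℚ k)) (cong (_+ u) (sym (ℕ→ℚ-+ m k)))
  where
  swap : ∀ a b c → a + b + c ≡ a + c + b
  swap = solve-∀ ℚ-ring

ℕ→ℚ-*-≡ : ∀ a b {c} → a ℕ.* b ≡ c → ℕ→ℚ a * ℕ→ℚ b ≡ ℕ→ℚ c
ℕ→ℚ-*-≡ a b ab≡c = trans (sym (ℕ→ℚ-* a b)) (cong ℕ→ℚ ab≡c)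

ℕ→ℚ-injective : ∀ {a b} → ℕ→ℚ a ≡ ℕ→ℚ b → a ≡ b
ℕ→ℚ-injective {a} {b} e = ℤP.+-injective (trans (sym (↥-ℤ→ℚ (+ a))) (trans (cong ↥_ e) (↥-ℤ→ℚ (+ b))))

ℕ→ℚ-≢0 : ∀ {d} → d ≢ 0 → ℕ→ℚ d ≢ 0ℚ
ℕ→ℚ-≢0 d≢0 e = d≢0 (ℕ→ℚ-injective e)

÷'-as-* : ∀ a b → a ÷' b ≡ a * (1ℚ ÷' b)
÷'-as-* a b with b ≟ 0ℚ
... | yes _ = sym (ℚP.*-zeroʳ a)
... | no _  = cong (a *_) (sym (ℚP.*-identityˡ _))

1÷'-inverseʳ : ∀ {b} → b ≢ 0ℚ → b * (1ℚ ÷' b) ≡ 1ℚ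
1÷'-inverseʳ {b} b≢0 with b ≟ 0ℚ
... | yes b≡0 = ⊥-elim (b≢0 b≡0)
... | no b≢0′ = trans (cong (b *_) (ℚP.*-identityˡ _)) (ℚP.*-inverseʳ b {{ℚ.≢-nonZero b≢0′}})

÷'-*-cancel : ∀ a {b} → b ≢ 0ℚ → (a ÷' b) * b ≡ a
÷'-*-cancel a {b} b≢0 = begin
  (a ÷' b) * b         ≡⟨ cong (_* b) (÷'-as-* a b) ⟩
  a * (1ℚ ÷' b) * b    ≡⟨ assoc-comm a (1ℚ ÷' b) b ⟩
  a * (b * (1ℚ ÷' b))  ≡⟨ cong (a *_) (1÷'-inverseʳ b≢0) ⟩
  a * 1ℚ               ≡⟨ ℚP.*-identityʳ a ⟩
  a                    ∎
  where
  open ≡-Reasoning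
  assoc-comm : ∀ x y z → x * y * z ≡ x * (z * y)
  assoc-comm = solve-∀ ℚ-ring

*-÷'-cancel : ∀ a {b} → b ≢ 0ℚ → (b * a) ÷' b ≡ a
*-÷'-cancel a {b} b≢0 = begin
  (b * a) ÷' b          ≡⟨ ÷'-as-* (b * a) b ⟩
  b * a * (1ℚ ÷' b)     ≡⟨ assoc-comm b a (1ℚ ÷' b) ⟩
  a * (b * (1ℚ ÷' b))   ≡⟨ cong (a *_) (1÷'-inverseʳ b≢0) ⟩
  a * 1ℚ                ≡⟨ ℚP.*-identityʳ a ⟩
  a                     ∎
  where
  open ≡-Reasoning
  assoc-comm : ∀ x y z → x * y * z ≡ y * (x * z)
  assoc-comm = solve-∀ ℚ-ring

∏ : ℕ → (ℕ → ℚ) → ℚ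
∏ zero    f = 1ℚ
∏ (suc n) f = f n * ∏ n f

∑ : ℕ → (ℕ → ℚ) → ℚ
∑ zero    f = 0ℚ
∑ (suc n) f = f n + ∑ n f

∏-cong : ∀ {f g} n → (∀ i → i < n → f i ≡ g i) → ∏ n f ≡ ∏ n g
∏-cong zero    f≗g = refl
∏-cong (suc n) f≗g = cong₂ _*_ (f≗g n ℕP.≤-refl) (∏-cong n (λ i i<n → f≗g i (ℕP.m<n⇒m<1+n i<n)))

∏-+ : ∀ f a b → ∏ (a ℕ.+ b) f ≡ ∏ b (λ i → f (a ℕ.+ i)) * ∏ a f
∏-+ f a zero    = trans (cong (λ n → ∏ n f) (ℕP.+-identityʳ a)) (sym (ℚP.*-identityˡ _))
∏-+ f a (suc b) = begin
  ∏ (a ℕ.+ suc b) f                                      ≡⟨ cong (λ n → ∏ n f) (ℕP.+-suc a b) ⟩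
  f (a ℕ.+ b) * ∏ (a ℕ.+ b) f                            ≡⟨ cong (f (a ℕ.+ b) *_) (∏-+ f a b) ⟩
  f (a ℕ.+ b) * (∏ b (λ i → f (a ℕ.+ i)) * ∏ a f)        ≡⟨ ℚP.*-assoc (f (a ℕ.+ b)) _ _ ⟨
  f (a ℕ.+ b) * ∏ b (λ i → f (a ℕ.+ i)) * ∏ a f          ∎
  where open ≡-Reasoning

infixl 8 _↓_

_↓_ : ℚ → ℕ → ℚ
z ↓ n = ∏ n (λ i → z - ℕ→ℚ i)

↓-+ : ∀ z a b → z ↓ (a ℕ.+ b) ≡ (z - ℕ→ℚ a) ↓ b * z ↓ a
↓-+ z a b = trans (∏-+ (λ i → z - ℕ→ℚ i) a b)
                  (cong (_* z ↓ a) (∏-cong b (λ i _ → shift i)))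
  where
  sub-+ : ∀ z a i → z - (a + i) ≡ z - a - i
  sub-+ = solve-∀ ℚ-ring
  shift : ∀ i → z - ℕ→ℚ (a ℕ.+ i) ≡ z - ℕ→ℚ a - ℕ→ℚ i
  shift i = trans (cong (λ w → z - w) (ℕ→ℚ-+ a i)) (sub-+ z (ℕ→ℚ a) (ℕ→ℚ i))

↓-suc : ∀ z n → z ↓ suc n ≡ z * (z - 1ℚ) ↓ n
↓-suc z zero    = z-0≡z z
  where
  z-0≡z : ∀ z → (z - 0ℚ) * 1ℚ ≡ z * 1ℚ
  z-0≡z = solve-∀ ℚ-ring
↓-suc z (suc n) = begin
  (z - ℕ→ℚ (suc n)) * z ↓ suc n            ≡⟨ cong₂ (λ a b → (z - a) * b) (ℕ→ℚ-+ 1 n) (↓-suc z n) ⟩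
  (z - (1ℚ + ℕ→ℚ n)) * (z * (z - 1ℚ) ↓ n)   ≡⟨ rearrange z (ℕ→ℚ n) ((z - 1ℚ) ↓ n) ⟩
  z * ((z - 1ℚ - ℕ→ℚ n) * (z - 1ℚ) ↓ n)     ∎
  where
  open ≡-Reasoning
  rearrange : ∀ z n F → (z - (1ℚ + n)) * (z * F) ≡ z * ((z - 1ℚ - n) * F)
  rearrange = solve-∀ ℚ-ring

↓-split : ∀ c j u → (ℕ→ℚ c + u) ↓ (c ℕ.+ suc j) ≡ u * (u - 1ℚ) ↓ j * (ℕ→ℚ c + u) ↓ c
↓-split c j u = begin
  (ℕ→ℚ c + u) ↓ (c ℕ.+ suc j)                          ≡⟨ ↓-+ (ℕ→ℚ c + u) c (suc j) ⟩
  (ℕ→ℚ c + u - ℕ→ℚ c) ↓ suc j * (ℕ→ℚ c + u) ↓ c        ≡⟨ cong (λ z → z ↓ suc j * (ℕ→ℚ c + u) ↓ c) (cancel (ℕ→ℚ c) u) ⟩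
  u ↓ suc j * (ℕ→ℚ c + u) ↓ c                          ≡⟨ cong (_* (ℕ→ℚ c + u) ↓ c) (↓-suc u j) ⟩
  u * (u - 1ℚ) ↓ j * (ℕ→ℚ c + u) ↓ c                   ∎
  where
  open ≡-Reasoning
  cancel : ∀ c u → c + u - c ≡ u
  cancel = solve-∀ ℚ-ring

↓-ℕ : ∀ c n → n ≤ c → ℕ→ℚ c ↓ n ≡ ℕ→ℚ (c P′ n)
↓-ℕ c zero    _   = refl
↓-ℕ c (suc n) n<c = begin
  (ℕ→ℚ c - ℕ→ℚ n) * ℕ→ℚ c ↓ n    ≡⟨ cong₂ _*_ (sym (ℕ→ℚ-∸ (ℕP.<⇒≤ n<c))) (↓-ℕ c n (ℕP.<⇒≤ n<c)) ⟩
  ℕ→ℚ (c ∸ n) * ℕ→ℚ (c P′ n)     ≡⟨ ℕ→ℚ-* (c ∸ n) (c P′ n) ⟨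
  ℕ→ℚ (c P′ suc n)               ∎
  where open ≡-Reasoning

binomQ-*-! : ∀ z k → binomQ z k * ℕ→ℚ (k !) ≡ z ↓ k
binomQ-*-! z zero    = refl
binomQ-*-! z (suc k) = begin
  binomQ z (suc k) * ℕ→ℚ (suc k ℕ.* k !)                  ≡⟨ cong (binomQ z (suc k) *_) (ℕ→ℚ-* (suc k) (k !)) ⟩
  binomQ z (suc k) * (ℕ→ℚ (suc k) * ℕ→ℚ (k !))            ≡⟨ ℚP.*-assoc (binomQ z (suc k)) _ _ ⟨
  binomQ z (suc k) * ℕ→ℚ (suc k) * ℕ→ℚ (k !)              ≡⟨ cong (_* ℕ→ℚ (k !)) (÷'-*-cancel (binomQ z k * (z - ℕ→ℚ k)) (ℕ→ℚ-≢0 {suc k} λ ())) ⟩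
  binomQ z k * (z - ℕ→ℚ k) * ℕ→ℚ (k !)                    ≡⟨ rearrange (binomQ z k) (z - ℕ→ℚ k) (ℕ→ℚ (k !)) ⟩
  (z - ℕ→ℚ k) * (binomQ z k * ℕ→ℚ (k !))                  ≡⟨ cong ((z - ℕ→ℚ k) *_) (binomQ-*-! z k) ⟩
  z ↓ suc k                                               ∎
  where
  open ≡-Reasoning
  rearrange : ∀ b s f → b * s * f ≡ s * (b * f)
  rearrange = solve-∀ ℚ-ring

binomProduct : ℕ → ℚ → ℚ
binomProduct k y = binomQ y k * binomQ (y + ℕ→ℚ k) k

binomProduct*k!*k!≡↓*↓ : ∀ k z → binomProduct k z * ℕ→ℚ (k ! ℕ.* k !) ≡ z ↓ k * (z + ℕ→ℚ k) ↓ k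
binomProduct*k!*k!≡↓*↓ k z = begin
  binomQ z k * binomQ (z + ℕ→ℚ k) k * ℕ→ℚ (k ! ℕ.* k !)            ≡⟨ cong (binomQ z k * binomQ (z + ℕ→ℚ k) k *_) (ℕ→ℚ-* (k !) (k !)) ⟩
  binomQ z k * binomQ (z + ℕ→ℚ k) k * (ℕ→ℚ (k !) * ℕ→ℚ (k !))      ≡⟨ interchange (binomQ z k) (binomQ (z + ℕ→ℚ k) k) (ℕ→ℚ (k !)) ⟩
  binomQ z k * ℕ→ℚ (k !) * (binomQ (z + ℕ→ℚ k) k * ℕ→ℚ (k !))      ≡⟨ cong₂ _*_ (binomQ-*-! z k) (binomQ-*-! (z + ℕ→ℚ k) k) ⟩
  z ↓ k * (z + ℕ→ℚ k) ↓ k                                          ∎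
  where
  open ≡-Reasoning
  interchange : ∀ a b f → a * b * (f * f) ≡ a * f * (b * f)
  interchange = solve-∀ ℚ-ring

binomProduct*k!*k!-split : ∀ m j u → let k = m ℕ.+ suc j in
  binomProduct k (ℕ→ℚ m + u) * ℕ→ℚ (k ! ℕ.* k !) ≡ u * (u - 1ℚ) ↓ j * (ℕ→ℚ m + u) ↓ m * (ℕ→ℚ (m ℕ.+ k) + u) ↓ k
binomProduct*k!*k!-split m j u =
  trans (binomProduct*k!*k!≡↓*↓ (m ℕ.+ suc j) (ℕ→ℚ m + u))
        (cong₂ (λ a b → a * b ↓ (m ℕ.+ suc j)) (↓-split m j u) (+-shift m (m ℕ.+ suc j) u))

<⇒≡+suc : ∀ {m n} → m < n → Σ ℕ λ j → n ≡ m ℕ.+ suc j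
<⇒≡+suc {m} m<n with ℕP.m≤n⇒∃[o]m+o≡n m<n
... | j , 1+m+j≡n = j , trans (sym 1+m+j≡n) (sym (ℕP.+-suc m j))

nCk*[k!*[n∸k]!]≡n! : ∀ {n k} → k ≤ n → (n C k) ℕ.* (k ! ℕ.* (n ∸ k) !) ≡ n !
nCk*[k!*[n∸k]!]≡n! {n} {k} k≤n =
  trans (cong (ℕ._* (k ! ℕ.* (n ∸ k) !)) (nCk≡n!/k![n-k]! k≤n)) (m/n*n≡m (k![n∸k]!∣n! k≤n))
  where instance _ = k ℕP.!* (n ∸ k) !≢0

nP′k*[n∸k]!≡n! : ∀ {n k} → k ≤ n → (n P′ k) ℕ.* (n ∸ k) ! ≡ n !
nP′k*[n∸k]!≡n! {n} {k} k≤n =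
  trans (cong (ℕ._* (n ∸ k) !) (nP′k≡n!/[n∸k]! k≤n))
        (m/n*n≡m (ℕD.∣-trans (ℕD.m∣m*n (k !)) ([n∸k]!k!∣n! k≤n)))
  where instance _ = (n ∸ k) ℕP.!≢0

nCk*k!≡nP′k : ∀ {n k} → k ≤ n → (n C k) ℕ.* k ! ≡ n P′ k
nCk*k!≡nP′k {n} {k} k≤n = ℕP.*-cancelʳ-≡ _ _ ((n ∸ k) !) {{(n ∸ k) ℕP.!≢0}} (begin
  (n C k) ℕ.* k ! ℕ.* (n ∸ k) !    ≡⟨ ℕP.*-assoc (n C k) (k !) _ ⟩
  (n C k) ℕ.* (k ! ℕ.* (n ∸ k) !)    ≡⟨ nCk*[k!*[n∸k]!]≡n! k≤n ⟩
  n !                              ≡⟨ nP′k*[n∸k]!≡n! k≤n ⟨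
  (n P′ k) ℕ.* (n ∸ k) !             ∎)
  where open ≡-Reasoning

[m+k]Ck*k!*k!≡j!*m!*[m+k]P′k*[k∸m]*kCm : ∀ m j → let k = m ℕ.+ suc j in
  ((m ℕ.+ k) C k) ℕ.* (k ! ℕ.* k !) ≡ j ! ℕ.* (m ! ℕ.* ((m ℕ.+ k) P′ k)) ℕ.* ((k ∸ m) ℕ.* (k C m))
[m+k]Ck*k!*k!≡j!*m!*[m+k]P′k*[k∸m]*kCm m j = begin
  Cₖ ℕ.* (k ! ℕ.* k !)                                      ≡⟨ ℕP.*-assoc Cₖ (k !) (k !) ⟨
  Cₖ ℕ.* k ! ℕ.* k !                                        ≡⟨ cong (ℕ._* k !) (nCk*k!≡nP′k (ℕP.m≤n+m k m)) ⟩
  R ℕ.* k !                                                ≡⟨ cong (R ℕ.*_) (nCk*[k!*[n∸k]!]≡n! m≤k) ⟨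
  R ℕ.* ((k C m) ℕ.* (m ! ℕ.* (k ∸ m) !))                  ≡⟨ cong (λ i → R ℕ.* ((k C m) ℕ.* (m ! ℕ.* i !))) k∸m≡1+j ⟩
  R ℕ.* ((k C m) ℕ.* (m ! ℕ.* (suc j ℕ.* j !)))            ≡⟨ reorder R (k C m) (m !) (suc j) (j !) ⟩
  j ! ℕ.* (m ! ℕ.* R) ℕ.* (suc j ℕ.* (k C m))              ≡⟨ cong (λ i → j ! ℕ.* (m ! ℕ.* R) ℕ.* (i ℕ.* (k C m))) k∸m≡1+j ⟨
  j ! ℕ.* (m ! ℕ.* R) ℕ.* ((k ∸ m) ℕ.* (k C m))            ∎
  where
  open ≡-Reasoning
  k = m ℕ.+ suc j
  Cₖ = (m ℕ.+ k) C k
  R = (m ℕ.+ k) P′ k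
  m≤k = ℕP.m≤m+n m (suc j)
  k∸m≡1+j : k ∸ m ≡ suc j
  k∸m≡1+j = ℕP.m+n∸m≡n m (suc j)
  reorder : ∀ R Ckm mf sj jf → R ℕ.* (Ckm ℕ.* (mf ℕ.* (sj ℕ.* jf))) ≡ jf ℕ.* (mf ℕ.* R) ℕ.* (sj ℕ.* Ckm)
  reorder = ℕSolver.solve-∀

j!*c!*k*[k∸m]*mCa*kCm*[m+j]!*a!≡k!*k! : ∀ c a j → let m = c ℕ.+ a; k = m ℕ.+ suc j in
  j ! ℕ.* c ! ℕ.* (k ℕ.* (k ∸ m) ℕ.* (m C a) ℕ.* (k C m)) ℕ.* ((m ℕ.+ j) ! ℕ.* a !) ≡ k ! ℕ.* k !
j!*c!*k*[k∸m]*mCa*kCm*[m+j]!*a!≡k!*k! c a j = begin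
  j ! ℕ.* c ! ℕ.* (k ℕ.* (k ∸ m) ℕ.* (m C a) ℕ.* (k C m)) ℕ.* ((m ℕ.+ j) ! ℕ.* a !)
    ≡⟨ cong (λ i → j ! ℕ.* c ! ℕ.* (k ℕ.* i ℕ.* (m C a) ℕ.* (k C m)) ℕ.* ((m ℕ.+ j) ! ℕ.* a !)) k∸m≡1+j ⟩
  j ! ℕ.* c ! ℕ.* (k ℕ.* suc j ℕ.* (m C a) ℕ.* (k C m)) ℕ.* ((m ℕ.+ j) ! ℕ.* a !)
    ≡⟨ reorder (j !) (c !) k (suc j) (m C a) (k C m) ((m ℕ.+ j) !) (a !) ⟩
  (k ℕ.* (m ℕ.+ j) !) ℕ.* ((k C m) ℕ.* (((m C a) ℕ.* (a ! ℕ.* c !)) ℕ.* (suc j ℕ.* j !)))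
    ≡⟨ cong₂ (λ u v → u ℕ.* ((k C m) ℕ.* (v ℕ.* (suc j ℕ.* j !)))) k*[m+j]!≡k! m!≡ ⟩
  k ! ℕ.* ((k C m) ℕ.* (m ! ℕ.* (suc j) !))
    ≡⟨ cong (λ i → k ! ℕ.* ((k C m) ℕ.* (m ! ℕ.* i !))) k∸m≡1+j ⟨
  k ! ℕ.* ((k C m) ℕ.* (m ! ℕ.* (k ∸ m) !))
    ≡⟨ cong (k ! ℕ.*_) (nCk*[k!*[n∸k]!]≡n! (ℕP.m≤m+n m (suc j))) ⟩
  k ! ℕ.* k ! ∎
  where
  open ≡-Reasoning
  m = c ℕ.+ a
  k = m ℕ.+ suc j
  k∸m≡1+j : k ∸ m ≡ suc j
  k∸m≡1+j = ℕP.m+n∸m≡n m (suc j)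
  k*[m+j]!≡k! : k ℕ.* (m ℕ.+ j) ! ≡ k !
  k*[m+j]!≡k! = trans (cong (ℕ._* (m ℕ.+ j) !) (ℕP.+-suc m j)) (cong _! (sym (ℕP.+-suc m j)))
  m!≡ : (m C a) ℕ.* (a ! ℕ.* c !) ≡ m !
  m!≡ = subst (λ i → (m C a) ℕ.* (a ! ℕ.* i !) ≡ m !) (ℕP.m+n∸n≡m c a) (nCk*[k!*[n∸k]!]≡n! (ℕP.m≤n+m a c))
  reorder : ∀ jf cf k sj mCa kCm f af →
    jf ℕ.* cf ℕ.* (k ℕ.* sj ℕ.* mCa ℕ.* kCm) ℕ.* (f ℕ.* af) ≡ (k ℕ.* f) ℕ.* (kCm ℕ.* ((mCa ℕ.* (af ℕ.* cf)) ℕ.* (sj ℕ.* jf)))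
  reorder = ℕSolver.solve-∀

negOnePow-+ : ∀ a b → negOnePow (a ℕ.+ b) ≡ negOnePow a * negOnePow b
negOnePow-+ zero    b = sym (ℚP.*-identityˡ _)
negOnePow-+ (suc a) b = trans (cong -_ (negOnePow-+ a b)) (ℚP.neg-distribˡ-* (negOnePow a) (negOnePow b))

negOnePow-*-self : ∀ a → negOnePow a * negOnePow a ≡ 1ℚ
negOnePow-*-self zero    = refl
negOnePow-*-self (suc a) = trans (neg*neg (negOnePow a)) (negOnePow-*-self a)
  where
  neg*neg : ∀ x → (- x) * (- x) ≡ x * x
  neg*neg = solve-∀ ℚ-ring

negOnePow-[a+a] : ∀ a → negOnePow (a ℕ.+ a) ≡ 1ℚ
negOnePow-[a+a] a = trans (negOnePow-+ a a) (negOnePow-*-self a)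

negOnePow-+-even : ∀ {a b c d} → a ℕ.+ (b ℕ.+ b) ≡ c ℕ.+ (d ℕ.+ d) → negOnePow a ≡ negOnePow c
negOnePow-+-even {a} {b} {c} {d} eq = begin
  negOnePow a                                   ≡⟨ ℚP.*-identityʳ _ ⟨
  negOnePow a * 1ℚ                              ≡⟨ cong (negOnePow a *_) (negOnePow-[a+a] b) ⟨
  negOnePow a * negOnePow (b ℕ.+ b)             ≡⟨ negOnePow-+ a (b ℕ.+ b) ⟨
  negOnePow (a ℕ.+ (b ℕ.+ b))                   ≡⟨ cong negOnePow eq ⟩
  negOnePow (c ℕ.+ (d ℕ.+ d))                   ≡⟨ negOnePow-+ c (d ℕ.+ d) ⟩
  negOnePow c * negOnePow (d ℕ.+ d)             ≡⟨ cong (negOnePow c *_) (negOnePow-[a+a] d) ⟩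
  negOnePow c * 1ℚ                              ≡⟨ ℚP.*-identityʳ _ ⟩
  negOnePow c                                   ∎
  where open ≡-Reasoning

negOnePow[j]*negOnePow[j+a]≡negOnePow[c+a+j] : ∀ {h} c a j → c ℕ.+ a ℕ.+ j ℕ.+ a ≡ h ℕ.+ h →
  negOnePow j * negOnePow (j ℕ.+ a) ≡ negOnePow (c ℕ.+ a ℕ.+ j)
negOnePow[j]*negOnePow[j+a]≡negOnePow[c+a+j] {h} c a j c+a+j+a≡h+h =
  trans (sym (negOnePow-+ j (j ℕ.+ a))) (negOnePow-+-even {j ℕ.+ (j ℕ.+ a)} {h} {c ℕ.+ a ℕ.+ j} {j ℕ.+ a} parity)
  where
  identity : ∀ c a j → j ℕ.+ (j ℕ.+ a) ℕ.+ (c ℕ.+ a ℕ.+ j ℕ.+ a) ≡ c ℕ.+ a ℕ.+ j ℕ.+ ((j ℕ.+ a) ℕ.+ (j ℕ.+ a))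
  identity = ℕSolver.solve-∀
  parity : j ℕ.+ (j ℕ.+ a) ℕ.+ (h ℕ.+ h) ≡ c ℕ.+ a ℕ.+ j ℕ.+ ((j ℕ.+ a) ℕ.+ (j ℕ.+ a))
  parity = trans (cong (j ℕ.+ (j ℕ.+ a) ℕ.+_) (sym c+a+j+a≡h+h)) (identity c a j)

∑-1÷'[c∸i]≡H : ∀ {c n} → n ≤ c → ∑ n (λ i → 1ℚ ÷' ℕ→ℚ (c ∸ i)) ≡ H c - H (c ∸ n)
∑-1÷'[c∸i]≡H {c} {zero}  _   = sym (ℚP.+-inverseʳ (H c))
∑-1÷'[c∸i]≡H {c} {suc n} n<c = begin
  1ℚ ÷' ℕ→ℚ (c ∸ n) + ∑ n (λ i → 1ℚ ÷' ℕ→ℚ (c ∸ i))    ≡⟨ cong (λ s → 1ℚ ÷' ℕ→ℚ (c ∸ n) + s) (∑-1÷'[c∸i]≡H (ℕP.<⇒≤ n<c)) ⟩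
  1ℚ ÷' ℕ→ℚ (c ∸ n) + (H c - H (c ∸ n))               ≡⟨ cong (λ d → 1ℚ ÷' ℕ→ℚ d + (H c - H d)) c∸n≡1+c∸[1+n] ⟩
  w + (H c - (H (c ∸ suc n) + w))                     ≡⟨ telescope w (H c) (H (c ∸ suc n)) ⟩
  H c - H (c ∸ suc n)                                 ∎
  where
  open ≡-Reasoning
  w = 1ℚ ÷' ℕ→ℚ (suc (c ∸ suc n))
  c∸n≡1+c∸[1+n] : c ∸ n ≡ suc (c ∸ suc n)
  c∸n≡1+c∸[1+n] = ℕP.+-∸-assoc 1 n<c
  telescope : ∀ w h h′ → w + (h - (h′ + w)) ≡ h - h′
  telescope = solve-∀ ℚ-ring

∏-neg≡negOnePow*! : ∀ n → ∏ n (λ i → - ℕ→ℚ (suc i)) ≡ negOnePow n * ℕ→ℚ (n !)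
∏-neg≡negOnePow*! zero    = refl
∏-neg≡negOnePow*! (suc n) = begin
  - ℕ→ℚ (suc n) * ∏ n (λ i → - ℕ→ℚ (suc i))            ≡⟨ cong (- ℕ→ℚ (suc n) *_) (∏-neg≡negOnePow*! n) ⟩
  - ℕ→ℚ (suc n) * (negOnePow n * ℕ→ℚ (n !))            ≡⟨ reorder (ℕ→ℚ (suc n)) (negOnePow n) (ℕ→ℚ (n !)) ⟩
  - negOnePow n * (ℕ→ℚ (suc n) * ℕ→ℚ (n !))            ≡⟨ cong (- negOnePow n *_) (ℕ→ℚ-* (suc n) (n !)) ⟨
  negOnePow (suc n) * ℕ→ℚ (suc n !)                    ∎
  where
  open ≡-Reasoning
  reorder : ∀ s σ f → - s * (σ * f) ≡ - σ * (s * f)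
  reorder = solve-∀ ℚ-ring

∑-neg≡-H : ∀ n → ∑ n (λ i → - (1ℚ ÷' ℕ→ℚ (suc i))) ≡ - H n
∑-neg≡-H zero    = refl
∑-neg≡-H (suc n) = trans (cong (λ s → - (1ℚ ÷' ℕ→ℚ (suc n)) + s) (∑-neg≡-H n)) (neg-+ _ (H n))
  where
  neg-+ : ∀ a b → - a + - b ≡ - (b + a)
  neg-+ = solve-∀ ℚ-ring

module Integrality {p : ℕ} (p-prime : Prime p) where

  P : ℚ
  P = ℕ→ℚ p

  1<p : 1 < p
  1<p = ℕ.nonTrivial⇒n>1 p {{prime⇒nonTrivial p-prime}}

  p∤1 : ¬ p ∣ 1
  p∤1 p∣1 = ℕP.<⇒≢ 1<p (sym (ℕD.∣1⇒≡1 p∣1))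

  p∤* : ∀ {a b} → ¬ p ∣ a → ¬ p ∣ b → ¬ p ∣ a ℕ.* b
  p∤* {a} {b} p∤a p∤b p∣ab with euclidsLemma a b p-prime p∣ab
  ... | inj₁ p∣a = p∤a p∣a
  ... | inj₂ p∣b = p∤b p∣b

  p∤-< : ∀ {d} → 0 < d → d < p → ¬ p ∣ d
  p∤-< {suc d} _ d<p p∣d = ℕP.<⇒≱ d<p (ℕD.∣⇒≤ p∣d)

  p∤! : ∀ {k} → k < p → ¬ p ∣ k !
  p∤! {zero}  _   = p∤1
  p∤! {suc k} k<p = p∤* (p∤-< (s≤s z≤n) k<p) (p∤! (ℕP.<-trans (ℕP.n<1+n k) k<p))

  p∤C : ∀ {n k} → k ≤ n → n < p → ¬ p ∣ n C k
  p∤C {n} {k} k≤n n<p p∣C =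
    p∤! n<p (subst (p ∣_) (nCk*[k!*[n∸k]!]≡n! k≤n) (ℕD.∣m⇒∣m*n (k ! ℕ.* (n ∸ k) !) p∣C))

  p∤k!*k! : ∀ {k} → k < p → ¬ p ∣ k ! ℕ.* k !
  p∤k!*k! k<p = p∤* (p∤! k<p) (p∤! k<p)

  p≢2⇒odd : p ≢ 2 → Σ ℕ λ h → p ≡ suc (h ℕ.+ h)
  p≢2⇒odd p≢2 with p ℕ.% 2 in p%2≡r | m%n<n p 2
  ... | zero | _ with prime⇒irreducible p-prime (ℕD.m%n≡0⇒n∣m p 2 p%2≡r)
  ...   | inj₂ 2≡p = ⊥-elim (p≢2 (sym 2≡p))
  p≢2⇒odd p≢2 | suc zero | _ = p ℕ./ 2 , (begin
    p                                ≡⟨ m≡m%n+[m/n]*n p 2 ⟩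
    p ℕ.% 2 ℕ.+ p ℕ./ 2 ℕ.* 2        ≡⟨ cong (ℕ._+ p ℕ./ 2 ℕ.* 2) p%2≡r ⟩
    1 ℕ.+ p ℕ./ 2 ℕ.* 2             ≡⟨ cong suc (ℕP.*-comm (p ℕ./ 2) 2) ⟩
    suc (p ℕ./ 2 ℕ.+ (p ℕ./ 2 ℕ.+ 0)) ≡⟨ cong (λ i → suc (p ℕ./ 2 ℕ.+ i)) (ℕP.+-identityʳ (p ℕ./ 2)) ⟩
    suc (p ℕ./ 2 ℕ.+ p ℕ./ 2)       ∎)
    where open ≡-Reasoning
  p≢2⇒odd p≢2 | suc (suc _) | s≤s (s≤s ())

  +suc≡p⇒<p : ∀ {x} r → x ℕ.+ suc r ≡ p → x < p
  +suc≡p⇒<p {x} r x+1+r≡p = subst (x <_) x+1+r≡p (ℕP.m<m+n x (s≤s z≤n))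

  p∤0 : ∀ {d} → ¬ p ∣ d → d ≢ 0
  p∤0 p∤d refl = p∤d (ℕD._∣0 p)

  -- The elements of ℤ₍ₚ₎ = ℚ ∩ ℤₚ.
  record Integral (a : ℚ) : Set where
    constructor integral
    field
      num       : ℤ
      den       : ℕ
      p∤den     : ¬ p ∣ den
      a*den≡num : a * ℕ→ℚ den ≡ ℤ→ℚ num

  Integral-ℤ : ∀ z → Integral (ℤ→ℚ z)
  Integral-ℤ z = integral z 1 p∤1 (ℚP.*-identityʳ (ℤ→ℚ z))

  Integral-ℕ : ∀ n → Integral (ℕ→ℚ n)
  Integral-ℕ n = Integral-ℤ (+ n)

  Integral-+ : ∀ {a b} → Integral a → Integral b → Integral (a + b)
  Integral-+ {a} {b} (integral u v p∤v av≡u) (integral s w p∤w bw≡s) =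
    integral (u ℤ.* + w ℤ.+ s ℤ.* + v) (v ℕ.* w) (p∤* p∤v p∤w) (begin
      (a + b) * ℕ→ℚ (v ℕ.* w)                      ≡⟨ cong ((a + b) *_) (ℕ→ℚ-* v w) ⟩
      (a + b) * (ℕ→ℚ v * ℕ→ℚ w)                    ≡⟨ distrib a b (ℕ→ℚ v) (ℕ→ℚ w) ⟩
      (a * ℕ→ℚ v) * ℕ→ℚ w + (b * ℕ→ℚ w) * ℕ→ℚ v    ≡⟨ cong₂ (λ x y → x * ℕ→ℚ w + y * ℕ→ℚ v) av≡u bw≡s ⟩
      ℤ→ℚ u * ℤ→ℚ (+ w) + ℤ→ℚ s * ℤ→ℚ (+ v)        ≡⟨ cong₂ _+_ (ℤ→ℚ-* u (+ w)) (ℤ→ℚ-* s (+ v)) ⟨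
      ℤ→ℚ (u ℤ.* + w) + ℤ→ℚ (s ℤ.* + v)            ≡⟨ ℤ→ℚ-+ (u ℤ.* + w) (s ℤ.* + v) ⟨
      ℤ→ℚ (u ℤ.* + w ℤ.+ s ℤ.* + v)                ∎)
    where
    open ≡-Reasoning
    distrib : ∀ a b v w → (a + b) * (v * w) ≡ (a * v) * w + (b * w) * v
    distrib = solve-∀ ℚ-ring

  Integral-* : ∀ {a b} → Integral a → Integral b → Integral (a * b)
  Integral-* {a} {b} (integral u v p∤v av≡u) (integral s w p∤w bw≡s) =
    integral (u ℤ.* s) (v ℕ.* w) (p∤* p∤v p∤w) (begin
      (a * b) * ℕ→ℚ (v ℕ.* w)       ≡⟨ cong ((a * b) *_) (ℕ→ℚ-* v w) ⟩
      (a * b) * (ℕ→ℚ v * ℕ→ℚ w)     ≡⟨ interchange a b (ℕ→ℚ v) (ℕ→ℚ w) ⟩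
      (a * ℕ→ℚ v) * (b * ℕ→ℚ w)     ≡⟨ cong₂ _*_ av≡u bw≡s ⟩
      ℤ→ℚ u * ℤ→ℚ s                 ≡⟨ ℤ→ℚ-* u s ⟨
      ℤ→ℚ (u ℤ.* s)                 ∎)
    where
    open ≡-Reasoning
    interchange : ∀ a b v w → (a * b) * (v * w) ≡ (a * v) * (b * w)
    interchange = solve-∀ ℚ-ring

  Integral-neg : ∀ {a} → Integral a → Integral (- a)
  Integral-neg {a} ia = subst Integral (-1*a≡-a a) (Integral-* (Integral-ℤ (ℤ.- + 1)) ia)
    where
    -1*a≡-a : ∀ a → (- 1ℚ) * a ≡ - a
    -1*a≡-a = solve-∀ ℚ-ring

  Integral-1÷' : ∀ {d} → ¬ p ∣ d → Integral (1ℚ ÷' ℕ→ℚ d)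
  Integral-1÷' {d} p∤d = integral (+ 1) d p∤d
    (trans (ℚP.*-comm (1ℚ ÷' ℕ→ℚ d) (ℕ→ℚ d)) (1÷'-inverseʳ (ℕ→ℚ-≢0 (p∤0 p∤d))))

  Integral-negOnePow : ∀ n → Integral (negOnePow n)
  Integral-negOnePow zero    = Integral-ℕ 1
  Integral-negOnePow (suc n) = Integral-neg (Integral-negOnePow n)

  p^_∣_ : ℕ → ℚ → Set
  p^ zero  ∣ a = Integral a
  p^ suc r ∣ a = Σ ℚ λ b → p^ r ∣ b × a ≡ P * b

  p^∣-P* : ∀ {r a} → p^ r ∣ a → p^ suc r ∣ (P * a)
  p^∣-P* {a = a} p^r∣a = a , p^r∣a , refl

  p^suc∣⇒p^∣ : ∀ {r a} → p^ suc r ∣ a → p^ r ∣ a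
  p^suc∣⇒p^∣ {zero}  (b , ib , refl)       = Integral-* (Integral-ℕ p) ib
  p^suc∣⇒p^∣ {suc r} (b , p^r+1∣b , refl) = p^∣-P* (p^suc∣⇒p^∣ p^r+1∣b)

  p^∣⇒Integral : ∀ {r a} → p^ r ∣ a → Integral a
  p^∣⇒Integral {zero}  ia    = ia
  p^∣⇒Integral {suc r} p^∣a = p^∣⇒Integral (p^suc∣⇒p^∣ p^∣a)

  p^∣-0 : ∀ {r} → p^ r ∣ 0ℚ
  p^∣-0 {zero}  = Integral-ℕ 0
  p^∣-0 {suc r} = 0ℚ , p^∣-0 , sym (ℚP.*-zeroʳ P)

  p^∣-+ : ∀ {r a b} → p^ r ∣ a → p^ r ∣ b → p^ r ∣ (a + b)
  p^∣-+ {zero}  ia ib = Integral-+ ia ib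
  p^∣-+ {suc r} (a′ , p^∣a′ , refl) (b′ , p^∣b′ , refl) =
    a′ + b′ , p^∣-+ p^∣a′ p^∣b′ , sym (ℚP.*-distribˡ-+ P a′ b′)

  p^∣-*ˡ : ∀ {r a c} → Integral c → p^ r ∣ a → p^ r ∣ (c * a)
  p^∣-*ˡ {zero}          ic ia = Integral-* ic ia
  p^∣-*ˡ {suc r} {c = c} ic (a′ , p^∣a′ , refl) =
    c * a′ , p^∣-*ˡ ic p^∣a′ , left-commute c P a′
    where
    left-commute : ∀ x y z → x * (y * z) ≡ y * (x * z)
    left-commute = solve-∀ ℚ-ring

  p^∣-*ʳ : ∀ {r a c} → p^ r ∣ a → Integral c → p^ r ∣ (a * c)
  p^∣-*ʳ {a = a} {c} p^∣a ic = subst (p^ _ ∣_) (ℚP.*-comm c a) (p^∣-*ˡ ic p^∣a)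

  infix 4 _≡_[p^_]

  -- A record rather than a defined function, so that a and b can be inferred from the type.
  record _≡_[p^_] (a b : ℚ) (r : ℕ) : Set where
    constructor ≡[p^]-by
    field p^∣diff : p^ r ∣ (a - b)
  open _≡_[p^_]

  ≡⇒≡[p^] : ∀ {r a b} → a ≡ b → a ≡ b [p^ r ]
  ≡⇒≡[p^] {a = a} refl = ≡[p^]-by (subst (p^ _ ∣_) (sym (ℚP.+-inverseʳ a)) p^∣-0)

  ≡[p^]-trans : ∀ {r a b c} → a ≡ b [p^ r ] → b ≡ c [p^ r ] → a ≡ c [p^ r ]
  ≡[p^]-trans {a = a} {b} {c} (≡[p^]-by a≡b) (≡[p^]-by b≡c) =
    ≡[p^]-by (subst (p^ _ ∣_) (telescope a b c) (p^∣-+ a≡b b≡c))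
    where
    telescope : ∀ a b c → (a - b) + (b - c) ≡ a - c
    telescope = solve-∀ ℚ-ring

  ≡[p^]-preorder : ℕ → Preorder 0ℓ 0ℓ 0ℓ
  ≡[p^]-preorder r = record
    { _≈_        = _≡_
    ; _≲_        = _≡_[p^ r ]
    ; isPreorder = record { isEquivalence = isEquivalence ; reflexive = ≡⇒≡[p^] ; trans = ≡[p^]-trans }
    }

  module ≡[p^]-Reasoning (r : ℕ) = Relation.Binary.Reasoning.Preorder (≡[p^]-preorder r)

  ≡[p^]-sym : ∀ {r a b} → a ≡ b [p^ r ] → b ≡ a [p^ r ]
  ≡[p^]-sym {a = a} {b} (≡[p^]-by a≡b) =
    ≡[p^]-by (subst (p^ _ ∣_) (negate a b) (p^∣-*ˡ (Integral-ℤ (ℤ.- + 1)) a≡b))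
    where
    negate : ∀ a b → (- 1ℚ) * (a - b) ≡ b - a
    negate = solve-∀ ℚ-ring

  ≡[p^]-weaken : ∀ {r a b} → a ≡ b [p^ suc r ] → a ≡ b [p^ r ]
  ≡[p^]-weaken (≡[p^]-by a≡b) = ≡[p^]-by (p^suc∣⇒p^∣ a≡b)

  ≡[p^]-*ˡ : ∀ {r a b} c → Integral c → a ≡ b [p^ r ] → c * a ≡ c * b [p^ r ]
  ≡[p^]-*ˡ {a = a} {b} c ic (≡[p^]-by a≡b) = ≡[p^]-by (subst (p^ _ ∣_) (distrib c a b) (p^∣-*ˡ ic a≡b))
    where
    distrib : ∀ c a b → c * (a - b) ≡ c * a - c * b
    distrib = solve-∀ ℚ-ring

  ≡[p^]-Integral : ∀ {r a b} → a ≡ b [p^ r ] → Integral b → Integral a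
  ≡[p^]-Integral {a = a} {b} (≡[p^]-by a≡b) ib = subst Integral (cancel a b) (Integral-+ (p^∣⇒Integral a≡b) ib)
    where
    cancel : ∀ a b → (a - b) + b ≡ a
    cancel = solve-∀ ℚ-ring

  ≡[p^]-* : ∀ {r a b c d} → a ≡ b [p^ r ] → c ≡ d [p^ r ] → Integral b → Integral d →
            a * c ≡ b * d [p^ r ]
  ≡[p^]-* {a = a} {b} {c} {d} a≡b c≡d ib id = ≡[p^]-by (subst (p^ _ ∣_) (split a b c d)
    (p^∣-+ (p^∣-*ʳ (p^∣diff a≡b) (≡[p^]-Integral c≡d id)) (p^∣-*ˡ ib (p^∣diff c≡d))))
    where
    split : ∀ a b c d → (a - b) * c + b * (c - d) ≡ a * c - b * d
    split = solve-∀ ℚ-ring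

  ≡[p^]-P* : ∀ {r a b} → a ≡ b [p^ r ] → P * a ≡ P * b [p^ suc r ]
  ≡[p^]-P* {r} {a} {b} (≡[p^]-by a≡b) = ≡[p^]-by (subst (p^ suc r ∣_) (distrib P a b) (p^∣-P* a≡b))
    where
    distrib : ∀ c a b → c * (a - b) ≡ c * a - c * b
    distrib = solve-∀ ℚ-ring

  ≡[p^]-cancelʳ : ∀ {r a b d} → ¬ p ∣ d → a * ℕ→ℚ d ≡ b * ℕ→ℚ d [p^ r ] → a ≡ b [p^ r ]
  ≡[p^]-cancelʳ {a = a} {b} {d} p∤d (≡[p^]-by ad≡bd) =
    ≡[p^]-by (subst (p^ _ ∣_) eq (p^∣-*ˡ (Integral-1÷' p∤d) ad≡bd))
    where
    D = ℕ→ℚ d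
    factor : ∀ w a b d → w * (a * d - b * d) ≡ (a - b) * (d * w)
    factor = solve-∀ ℚ-ring
    eq : (1ℚ ÷' D) * (a * D - b * D) ≡ a - b
    eq = trans (factor (1ℚ ÷' D) a b D)
               (trans (cong ((a - b) *_) (1÷'-inverseʳ (ℕ→ℚ-≢0 (p∤0 p∤d)))) (ℚP.*-identityʳ (a - b)))

  record Expansion (e X A S : ℚ) : Set where
    constructor expansion
    field
      X≡A[1+peS] : X ≡ A * (1ℚ + P * e * S) [p^ 2 ]
      Integral-A : Integral A
      Integral-S : Integral S

  Expansion⇒≡[p] : ∀ {e X A S} → Integral e → Expansion e X A S → X ≡ A [p^ 1 ]
  Expansion⇒≡[p] {e} {X} {A} {S} ie (expansion X≡A[1+peS] iA iS) =
    ≡[p^]-trans (≡[p^]-weaken X≡A[1+peS])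
      (≡[p^]-by (subst (p^ 1 ∣_) (first-order P A e S) (p^∣-P* (Integral-* (Integral-* iA ie) iS))))
    where
    first-order : ∀ P A e S → P * (A * e * S) ≡ A * (1ℚ + P * e * S) - A
    first-order = solve-∀ ℚ-ring

  Expansion-* : ∀ {e X₁ A₁ S₁ X₂ A₂ S₂} → Integral e →
                Expansion e X₁ A₁ S₁ → Expansion e X₂ A₂ S₂ →
                Expansion e (X₁ * X₂) (A₁ * A₂) (S₁ + S₂)
  Expansion-* {e} {X₁} {A₁} {S₁} {X₂} {A₂} {S₂} ie (expansion c₁ iA₁ iS₁) (expansion c₂ iA₂ iS₂) =
    expansion (≡[p^]-trans (≡[p^]-* c₁ c₂ (Integral-A[1+peS] iA₁ iS₁) (Integral-A[1+peS] iA₂ iS₂))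
                           second-order)
              (Integral-* iA₁ iA₂) (Integral-+ iS₁ iS₂)
    where
    Integral-A[1+peS] : ∀ {A S} → Integral A → Integral S → Integral (A * (1ℚ + P * e * S))
    Integral-A[1+peS] iA iS =
      Integral-* iA (Integral-+ (Integral-ℕ 1) (Integral-* (Integral-* (Integral-ℕ p) ie) iS))
    product : ∀ P e A₁ S₁ A₂ S₂ →
      P * (P * (A₁ * A₂ * e * e * S₁ * S₂)) ≡
      A₁ * (1ℚ + P * e * S₁) * (A₂ * (1ℚ + P * e * S₂)) - A₁ * A₂ * (1ℚ + P * e * (S₁ + S₂))
    product = solve-∀ ℚ-ring
    second-order : A₁ * (1ℚ + P * e * S₁) * (A₂ * (1ℚ + P * e * S₂)) ≡
                   A₁ * A₂ * (1ℚ + P * e * (S₁ + S₂)) [p^ 2 ]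
    second-order = ≡[p^]-by (subst (p^ 2 ∣_) (product P e A₁ S₁ A₂ S₂)
      (p^∣-P* (p^∣-P* (Integral-* (Integral-* (Integral-* (Integral-* (Integral-* iA₁ iA₂) ie) ie) iS₁) iS₂))))

  Expansion-∏ : ∀ {e} (a w : ℕ → ℚ) n → Integral e →
                (∀ i → i < n → Integral (a i) × Integral (w i) × a i * w i ≡ 1ℚ) →
                Expansion e (∏ n (λ i → a i + P * e)) (∏ n a) (∑ n w)
  Expansion-∏ {e} a w zero    ie _ = expansion (≡⇒≡[p^] (empty P e)) (Integral-ℕ 1) (Integral-ℕ 0)
    where
    empty : ∀ P e → 1ℚ ≡ 1ℚ * (1ℚ + P * e * 0ℚ)
    empty = solve-∀ ℚ-ring
  Expansion-∏ {e} a w (suc n) ie inverses =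
    Expansion-* ie (expansion (≡⇒≡[p^] factor) ia iw)
                   (Expansion-∏ a w n ie (λ i i<n → inverses i (ℕP.m<n⇒m<1+n i<n)))
    where
    ia = proj₁ (inverses n ℕP.≤-refl)
    iw = proj₁ (proj₂ (inverses n ℕP.≤-refl))
    aw≡1 = proj₂ (proj₂ (inverses n ℕP.≤-refl))
    expand : ∀ a w P e → a * (1ℚ + P * e * w) ≡ a + P * e * (a * w)
    expand = solve-∀ ℚ-ring
    factor : a n + P * e ≡ a n * (1ℚ + P * e * w n)
    factor = begin
      a n + P * e                   ≡⟨ cong (λ z → a n + z) (ℚP.*-identityʳ (P * e)) ⟨
      a n + P * e * 1ℚ              ≡⟨ cong (λ z → a n + P * e * z) aw≡1 ⟨
      a n + P * e * (a n * w n)     ≡⟨ expand (a n) (w n) P e ⟨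
      a n * (1ℚ + P * e * w n)      ∎
      where open ≡-Reasoning

  Expansion-cong : ∀ {e X X′ A A′ S S′} → X ≡ X′ → A ≡ A′ → S ≡ S′ →
                   Expansion e X A S → Expansion e X′ A′ S′
  Expansion-cong refl refl refl x = x

  ↓-expansion⁺ : ∀ {c n e} → n ≤ c → c < p → Integral e →
                 Expansion e ((ℕ→ℚ c + P * e) ↓ n) (ℕ→ℚ (c P′ n)) (H c - H (c ∸ n))
  ↓-expansion⁺ {c} {n} {e} n≤c c<p ie =
    Expansion-cong (∏-cong n (λ i i<n → shift i (i≤c i<n)))
                   (trans (∏-cong n (λ i i<n → ℕ→ℚ-∸ (i≤c i<n))) (↓-ℕ c n n≤c))
                   (∑-1÷'[c∸i]≡H n≤c)
                   (Expansion-∏ (λ i → ℕ→ℚ (c ∸ i)) (λ i → 1ℚ ÷' ℕ→ℚ (c ∸ i)) n ie inverses)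
    where
    i≤c : ∀ {i} → i < n → i ≤ c
    i≤c i<n = ℕP.≤-trans (ℕP.<⇒≤ i<n) n≤c
    reorder : ∀ c i pe → (c - i) + pe ≡ (c + pe) - i
    reorder = solve-∀ ℚ-ring
    shift : ∀ i → i ≤ c → ℕ→ℚ (c ∸ i) + P * e ≡ (ℕ→ℚ c + P * e) - ℕ→ℚ i
    shift i i≤c = trans (cong (_+ P * e) (ℕ→ℚ-∸ i≤c)) (reorder (ℕ→ℚ c) (ℕ→ℚ i) (P * e))
    inverses : ∀ i → i < n → Integral (ℕ→ℚ (c ∸ i)) × Integral (1ℚ ÷' ℕ→ℚ (c ∸ i)) ×
                              ℕ→ℚ (c ∸ i) * (1ℚ ÷' ℕ→ℚ (c ∸ i)) ≡ 1ℚ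
    inverses i i<n = Integral-ℕ (c ∸ i) , Integral-1÷' p∤c∸i , 1÷'-inverseʳ (ℕ→ℚ-≢0 (p∤0 p∤c∸i))
      where
      p∤c∸i : ¬ p ∣ c ∸ i
      p∤c∸i = p∤-< (ℕP.m<n⇒0<n∸m (ℕP.<-≤-trans i<n n≤c)) (ℕP.≤-<-trans (ℕP.m∸n≤m c i) c<p)

  ↓-expansion⁻ : ∀ {n e} → n < p → Integral e →
                 Expansion e ((P * e - 1ℚ) ↓ n) (negOnePow n * ℕ→ℚ (n !)) (- H n)
  ↓-expansion⁻ {n} {e} n<p ie =
    Expansion-cong (∏-cong n (λ i _ → shift i)) (∏-neg≡negOnePow*! n) (∑-neg≡-H n)
                   (Expansion-∏ (λ i → - ℕ→ℚ (suc i)) (λ i → - (1ℚ ÷' ℕ→ℚ (suc i))) n ie inverses)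
    where
    reorder : ∀ i pe → - (1ℚ + i) + pe ≡ (pe - 1ℚ) - i
    reorder = solve-∀ ℚ-ring
    shift : ∀ i → - ℕ→ℚ (suc i) + P * e ≡ (P * e - 1ℚ) - ℕ→ℚ i
    shift i = trans (cong (λ s → - s + P * e) (ℕ→ℚ-+ 1 i)) (reorder (ℕ→ℚ i) (P * e))
    neg*neg : ∀ a b → - a * - b ≡ a * b
    neg*neg = solve-∀ ℚ-ring
    inverses : ∀ i → i < n → Integral (- ℕ→ℚ (suc i)) × Integral (- (1ℚ ÷' ℕ→ℚ (suc i))) ×
                              - ℕ→ℚ (suc i) * - (1ℚ ÷' ℕ→ℚ (suc i)) ≡ 1ℚ
    inverses i i<n = Integral-neg (Integral-ℕ (suc i)) , Integral-neg (Integral-1÷' p∤1+i) ,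
                     trans (neg*neg (ℕ→ℚ (suc i)) (1ℚ ÷' ℕ→ℚ (suc i))) (1÷'-inverseʳ (ℕ→ℚ-≢0 {suc i} λ ()))
      where
      p∤1+i : ¬ p ∣ suc i
      p∤1+i = p∤-< (s≤s z≤n) (ℕP.≤-<-trans i<n n<p)

  -- (a+b)!/b! = (p-1)(p-2)⋯(p-a) ≡ (-1)^a a!.  Comparing two instances makes Wilson's theorem unnecessary.
  a!*b!≡±[a+b]! : ∀ {a b} → a ℕ.+ suc b ≡ p →
                  ℕ→ℚ (a ! ℕ.* b !) ≡ negOnePow a * ℕ→ℚ ((a ℕ.+ b) !) [p^ 1 ]
  a!*b!≡±[a+b]! {a} {b} a+1+b≡p = begin
    ℕ→ℚ (a ! ℕ.* b !)                 ≡⟨ ℕ→ℚ-* (a !) (b !) ⟩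
    ℕ→ℚ (a !) * F                     ≡⟨ ℚP.*-identityˡ _ ⟨
    1ℚ * (ℕ→ℚ (a !) * F)              ≡⟨ cong (_* (ℕ→ℚ (a !) * F)) (negOnePow-*-self a) ⟨
    σ * σ * (ℕ→ℚ (a !) * F)           ≡⟨ square σ F (ℕ→ℚ (a !)) ⟨
    σ * F * (σ * ℕ→ℚ (a !))           ∼⟨ ≡[p^]-*ˡ (σ * F) iσF (≡[p^]-sym P′≡±!) ⟩
    σ * F * ℕ→ℚ ((a ℕ.+ b) P′ a)      ≡⟨ reorder σ F (ℕ→ℚ ((a ℕ.+ b) P′ a)) ⟩
    σ * (ℕ→ℚ ((a ℕ.+ b) P′ a) * F)    ≡⟨ cong (σ *_) (ℕ→ℚ-*-≡ ((a ℕ.+ b) P′ a) (b !) P′*b!≡[a+b]!) ⟩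
    σ * ℕ→ℚ ((a ℕ.+ b) !)             ∎
    where
    open ≡[p^]-Reasoning 1
    σ = negOnePow a
    F = ℕ→ℚ (b !)
    iσF = Integral-* (Integral-negOnePow a) (Integral-ℕ (b !))
    a<p : a < p
    a<p = +suc≡p⇒<p b a+1+b≡p
    cancel : ∀ x → (1ℚ + x) * 1ℚ - 1ℚ ≡ x
    cancel = solve-∀ ℚ-ring
    P*1-1≡a+b : P * 1ℚ - 1ℚ ≡ ℕ→ℚ (a ℕ.+ b)
    P*1-1≡a+b = begin-equality
      P * 1ℚ - 1ℚ                    ≡⟨ cong (λ z → ℕ→ℚ z * 1ℚ - 1ℚ) (trans (sym a+1+b≡p) (ℕP.+-suc a b)) ⟩
      ℕ→ℚ (suc (a ℕ.+ b)) * 1ℚ - 1ℚ  ≡⟨ cong (λ z → z * 1ℚ - 1ℚ) (ℕ→ℚ-+ 1 (a ℕ.+ b)) ⟩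
      (1ℚ + ℕ→ℚ (a ℕ.+ b)) * 1ℚ - 1ℚ ≡⟨ cancel (ℕ→ℚ (a ℕ.+ b)) ⟩
      ℕ→ℚ (a ℕ.+ b)                  ∎
    P′≡±! : ℕ→ℚ ((a ℕ.+ b) P′ a) ≡ σ * ℕ→ℚ (a !) [p^ 1 ]
    P′≡±! = subst (λ z → z ≡ σ * ℕ→ℚ (a !) [p^ 1 ])
                  (trans (cong (_↓ a) P*1-1≡a+b) (↓-ℕ (a ℕ.+ b) a (ℕP.m≤m+n a b)))
                  (Expansion⇒≡[p] (Integral-ℕ 1) (↓-expansion⁻ a<p (Integral-ℕ 1)))
    P′*b!≡[a+b]! : ((a ℕ.+ b) P′ a) ℕ.* b ! ≡ (a ℕ.+ b) !
    P′*b!≡[a+b]! = subst (λ i → ((a ℕ.+ b) P′ a) ℕ.* i ! ≡ (a ℕ.+ b) !) (ℕP.m+n∸m≡n a b)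
                         (nP′k*[n∸k]!≡n! (ℕP.m≤m+n a b))
    square : ∀ σ F A → σ * F * (σ * A) ≡ σ * σ * (A * F)
    square = solve-∀ ℚ-ring
    reorder : ∀ σ F A → σ * F * A ≡ σ * (A * F)
    reorder = solve-∀ ℚ-ring

  -- The right-hand sides of the three congruences, with T standing for t = (x - m)/p.
  formula₁ : ℕ → ℕ → ℚ → ℚ
  formula₁ m k T = ℕ→ℚ (m C k) * ℕ→ℚ ((m ℕ.+ k) C k) * ((1ℚ + P * T * H (m ℕ.+ k)) - P * T * H (m ∸ k))

  formula₂ : ℕ → ℕ → ℚ → ℚ
  formula₂ m k T =
    (negOnePow m * (P * P) * T * (T + 1ℚ)) ÷' (ℕ→ℚ k * ℕ→ℚ (k ∸ m) * ℕ→ℚ (m C (p ∸ k)) * ℕ→ℚ (k C m))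

  formula₃ : ℕ → ℕ → ℚ → ℚ
  formula₃ m k T =
    ((negOnePow (m ℕ.+ k ℕ.+ 1) * P * T * ℕ→ℚ ((m ℕ.+ k) C k)) ÷' (ℕ→ℚ (k ∸ m) * ℕ→ℚ (k C m)))
    * ((1ℚ + P * T * H (m ℕ.+ k)) - P * T * H (k ∸ m ∸ 1))

  binomProduct≡formula₁ : ∀ {m k T} → Integral T → k ≤ m → m ℕ.+ k < p →
                          binomProduct k (ℕ→ℚ m + P * T) ≡ formula₁ m k T [p^ 2 ]
  binomProduct≡formula₁ {m} {k} {T} iT k≤m m+k<p = ≡[p^]-cancelʳ (p∤k!*k! k<p) (begin
    binomProduct k y * KK                           ≡⟨ lhs ⟩
    y ↓ k * (ℕ→ℚ (m ℕ.+ k) + P * T) ↓ k             ∼⟨ Expansion.X≡A[1+peS] product-expansion ⟩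
    A * (1ℚ + P * T * S)                            ≡⟨ rhs ⟨
    formula₁ m k T * KK                             ∎)
    where
    open ≡[p^]-Reasoning 2
    y = ℕ→ℚ m + P * T
    K = ℕ→ℚ (k !)
    KK = ℕ→ℚ (k ! ℕ.* k !)
    m<p = ℕP.≤-<-trans (ℕP.m≤m+n m k) m+k<p
    k<p = ℕP.≤-<-trans k≤m m<p
    A = ℕ→ℚ (m P′ k) * ℕ→ℚ ((m ℕ.+ k) P′ k)
    S = (H m - H (m ∸ k)) + (H (m ℕ.+ k) - H m)
    product-expansion : Expansion T (y ↓ k * (ℕ→ℚ (m ℕ.+ k) + P * T) ↓ k) A S
    product-expansion = Expansion-* iT (↓-expansion⁺ k≤m m<p iT)
      (Expansion-cong refl refl (cong (λ i → H (m ℕ.+ k) - H i) (ℕP.m+n∸n≡m m k))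
                      (↓-expansion⁺ (ℕP.m≤n+m k m) m+k<p iT))
    lhs : binomProduct k y * KK ≡ y ↓ k * (ℕ→ℚ (m ℕ.+ k) + P * T) ↓ k
    lhs = trans (binomProduct*k!*k!≡↓*↓ k y) (cong (λ z → y ↓ k * z ↓ k) (+-shift m k (P * T)))
    reorder : ∀ C₁ C₂ E K → C₁ * C₂ * E * (K * K) ≡ (C₁ * K) * (C₂ * K) * E
    reorder = solve-∀ ℚ-ring
    regroup : ∀ P T H₊ H₋ Hₘ → (1ℚ + P * T * H₊) - P * T * H₋ ≡ 1ℚ + P * T * ((Hₘ - H₋) + (H₊ - Hₘ))
    regroup = solve-∀ ℚ-ring
    rhs : formula₁ m k T * KK ≡ A * (1ℚ + P * T * S)
    rhs = begin-equality
      C₁ * C₂ * E * KK                 ≡⟨ cong (C₁ * C₂ * E *_) (ℕ→ℚ-* (k !) (k !)) ⟩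
      C₁ * C₂ * E * (K * K)            ≡⟨ reorder C₁ C₂ E K ⟩
      (C₁ * K) * (C₂ * K) * E          ≡⟨ cong₂ (λ a b → a * b * E) (ℕ→ℚ-*-≡ (m C k) (k !) (nCk*k!≡nP′k k≤m))
                                                                     (ℕ→ℚ-*-≡ ((m ℕ.+ k) C k) (k !) (nCk*k!≡nP′k (ℕP.m≤n+m k m))) ⟩
      A * E                            ≡⟨ cong (A *_) (regroup P T (H (m ℕ.+ k)) (H (m ∸ k)) (H m)) ⟩
      A * (1ℚ + P * T * S)             ∎
      where
      C₁ = ℕ→ℚ (m C k)
      C₂ = ℕ→ℚ ((m ℕ.+ k) C k)
      E = (1ℚ + P * T * H (m ℕ.+ k)) - P * T * H (m ∸ k)

  formula₃*k!*k!*D : ∀ m j T → let k = m ℕ.+ suc j; Dₙ = (k ∸ m) ℕ.* (k C m) in Dₙ ≢ 0 →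
    formula₃ m k T * ℕ→ℚ (k ! ℕ.* k !) * ℕ→ℚ Dₙ
    ≡ ℕ→ℚ Dₙ * (P * (T * (negOnePow j * ℕ→ℚ (j ! ℕ.* (m ! ℕ.* ((m ℕ.+ k) P′ k)))
                         * ((1ℚ + P * T * H (m ℕ.+ k)) - P * T * H j))))
  formula₃*k!*k!*D m j T Dₙ≢0 = begin
    ((σ * P * T * Cₖ) ÷' D′) * E * KK * D      ≡⟨ cong (λ d → ((σ * P * T * Cₖ) ÷' D′) * E * KK * d) D≡D′ ⟩
    ((σ * P * T * Cₖ) ÷' D′) * E * KK * D′     ≡⟨ reorder₁ ((σ * P * T * Cₖ) ÷' D′) E KK D′ ⟩
    ((σ * P * T * Cₖ) ÷' D′) * D′ * (E * KK)   ≡⟨ cong (_* (E * KK)) (÷'-*-cancel (σ * P * T * Cₖ) D′≢0) ⟩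
    σ * P * T * Cₖ * (E * KK)                  ≡⟨ reorder₂ σ P T Cₖ E KK ⟩
    σ * (Cₖ * KK) * (P * (T * E))              ≡⟨ cong₂ (λ s c → s * c * (P * (T * E))) sign Cₖ*KK≡N*D ⟩
    negOnePow j * (ℕ→ℚ N * D) * (P * (T * E))  ≡⟨ reorder₃ (negOnePow j) (ℕ→ℚ N) D P T E ⟩
    D * (P * (T * (negOnePow j * ℕ→ℚ N * E)))  ≡⟨ cong (λ i → D * (P * (T * (negOnePow j * ℕ→ℚ N * E′ i)))) k∸m∸1≡j ⟩
    D * (P * (T * (negOnePow j * ℕ→ℚ N * E′ j)))  ∎
    where
    open ≡-Reasoning
    k = m ℕ.+ suc j
    Dₙ = (k ∸ m) ℕ.* (k C m)
    D = ℕ→ℚ Dₙ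
    KK = ℕ→ℚ (k ! ℕ.* k !)
    N = j ! ℕ.* (m ! ℕ.* ((m ℕ.+ k) P′ k))
    σ = negOnePow (m ℕ.+ k ℕ.+ 1)
    Cₖ = ℕ→ℚ ((m ℕ.+ k) C k)
    D′ = ℕ→ℚ (k ∸ m) * ℕ→ℚ (k C m)
    E′ : ℕ → ℚ
    E′ i = (1ℚ + P * T * H (m ℕ.+ k)) - P * T * H i
    E = E′ (k ∸ m ∸ 1)
    k∸m∸1≡j : k ∸ m ∸ 1 ≡ j
    k∸m∸1≡j = cong (_∸ 1) (ℕP.m+n∸m≡n m (suc j))
    D≡D′ : D ≡ D′
    D≡D′ = ℕ→ℚ-* (k ∸ m) (k C m)
    D′≢0 : D′ ≢ 0ℚ
    D′≢0 = subst (_≢ 0ℚ) D≡D′ (ℕ→ℚ-≢0 Dₙ≢0)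
    sign : σ ≡ negOnePow j
    sign = negOnePow-+-even {b = 0} {d = suc m} (parity m j)
      where
      parity : ∀ m j → m ℕ.+ (m ℕ.+ suc j) ℕ.+ 1 ℕ.+ (0 ℕ.+ 0) ≡ j ℕ.+ (suc m ℕ.+ suc m)
      parity = ℕSolver.solve-∀
    Cₖ*KK≡N*D : Cₖ * KK ≡ ℕ→ℚ N * D
    Cₖ*KK≡N*D = trans (ℕ→ℚ-*-≡ ((m ℕ.+ k) C k) (k ! ℕ.* k !) ([m+k]Ck*k!*k!≡j!*m!*[m+k]P′k*[k∸m]*kCm m j))
                      (ℕ→ℚ-* N Dₙ)
    reorder₁ : ∀ a E K D → a * E * K * D ≡ a * D * (E * K)
    reorder₁ = solve-∀ ℚ-ring
    reorder₂ : ∀ σ P T C E K → σ * P * T * C * (E * K) ≡ σ * (C * K) * (P * (T * E))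
    reorder₂ = solve-∀ ℚ-ring
    reorder₃ : ∀ σ N D P T E → σ * (N * D) * (P * (T * E)) ≡ D * (P * (T * (σ * N * E)))
    reorder₃ = solve-∀ ℚ-ring

  binomProduct≡formula₃-split : ∀ m j {T} → Integral T → m ℕ.+ (m ℕ.+ suc j) < p →
    binomProduct (m ℕ.+ suc j) (ℕ→ℚ m + P * T) ≡ formula₃ m (m ℕ.+ suc j) T [p^ 3 ]
  binomProduct≡formula₃-split m j {T} iT m+k<p =
    ≡[p^]-cancelʳ (p∤k!*k! k<p) (≡[p^]-cancelʳ p∤Dₙ (begin
      binomProduct k y * KK * D                ≡⟨ cong (_* D) (binomProduct*k!*k!-split m j (P * T)) ⟩
      P * T * F * Y * Z * D                    ≡⟨ reorder P T F Y Z D ⟩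
      D * (P * (T * (F * Y * Z)))              ∼⟨ ≡[p^]-*ˡ D (Integral-ℕ Dₙ) (≡[p^]-P* (≡[p^]-*ˡ T iT FYZ≡A[1+pTS])) ⟩
      D * (P * (T * (A * (1ℚ + P * T * S))))   ≡⟨ cong (λ e → D * (P * (T * (A * e)))) (regroup P T (H (m ℕ.+ k)) (H j) (H m)) ⟨
      D * (P * (T * (A * E)))                  ≡⟨ formula₃*k!*k!*D m j T (p∤0 p∤Dₙ) ⟨
      formula₃ m k T * KK * D                  ∎))
    where
    open ≡[p^]-Reasoning 3
    k = m ℕ.+ suc j
    y = ℕ→ℚ m + P * T
    F = (P * T - 1ℚ) ↓ j
    Y = y ↓ m
    Z = (ℕ→ℚ (m ℕ.+ k) + P * T) ↓ k
    KK = ℕ→ℚ (k ! ℕ.* k !)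
    Dₙ = (k ∸ m) ℕ.* (k C m)
    D = ℕ→ℚ Dₙ
    N = j ! ℕ.* (m ! ℕ.* ((m ℕ.+ k) P′ k))
    A = negOnePow j * ℕ→ℚ N
    S = (- H j + (H m - 0ℚ)) + (H (m ℕ.+ k) - H m)
    E = (1ℚ + P * T * H (m ℕ.+ k)) - P * T * H j
    k<p = ℕP.≤-<-trans (ℕP.m≤n+m k m) m+k<p
    m<p = ℕP.≤-<-trans (ℕP.m≤m+n m (suc j)) k<p
    j<p = ℕP.<-≤-trans (ℕP.n<1+n j) (ℕP.<⇒≤ (ℕP.≤-<-trans (ℕP.m≤n+m (suc j) m) k<p))
    p∤Dₙ : ¬ p ∣ Dₙ
    p∤Dₙ = p∤* (subst (λ i → ¬ p ∣ i) (sym (ℕP.m+n∸m≡n m (suc j))) (p∤-< (s≤s z≤n) (ℕP.≤-<-trans (ℕP.m≤n+m (suc j) m) k<p)))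
               (p∤C (ℕP.m≤m+n m (suc j)) k<p)
    A-cast : negOnePow j * ℕ→ℚ (j !) * ℕ→ℚ (m P′ m) * ℕ→ℚ ((m ℕ.+ k) P′ k) ≡ A
    A-cast = begin-equality
      negOnePow j * ℕ→ℚ (j !) * ℕ→ℚ (m P′ m) * ℕ→ℚ ((m ℕ.+ k) P′ k)
        ≡⟨ cong (λ i → negOnePow j * ℕ→ℚ (j !) * ℕ→ℚ i * ℕ→ℚ ((m ℕ.+ k) P′ k)) (nP′n≡n! m) ⟩
      negOnePow j * ℕ→ℚ (j !) * ℕ→ℚ (m !) * ℕ→ℚ ((m ℕ.+ k) P′ k)
        ≡⟨ reassociate (negOnePow j) (ℕ→ℚ (j !)) (ℕ→ℚ (m !)) (ℕ→ℚ ((m ℕ.+ k) P′ k)) ⟩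
      negOnePow j * (ℕ→ℚ (j !) * (ℕ→ℚ (m !) * ℕ→ℚ ((m ℕ.+ k) P′ k)))
        ≡⟨ cong (λ z → negOnePow j * (ℕ→ℚ (j !) * z)) (ℕ→ℚ-* (m !) ((m ℕ.+ k) P′ k)) ⟨
      negOnePow j * (ℕ→ℚ (j !) * ℕ→ℚ (m ! ℕ.* ((m ℕ.+ k) P′ k)))
        ≡⟨ cong (negOnePow j *_) (ℕ→ℚ-* (j !) (m ! ℕ.* ((m ℕ.+ k) P′ k))) ⟨
      A ∎
      where
      reassociate : ∀ σ a b c → σ * a * b * c ≡ σ * (a * (b * c))
      reassociate = solve-∀ ℚ-ring
    FYZ≡A[1+pTS] : F * Y * Z ≡ A * (1ℚ + P * T * S) [p^ 2 ]
    FYZ≡A[1+pTS] = Expansion.X≡A[1+peS] (Expansion-cong refl A-cast refl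
      (Expansion-* iT (Expansion-* iT (↓-expansion⁻ j<p iT)
                                      (Expansion-cong refl refl (cong (λ i → H m - H i) (ℕP.n∸n≡0 m))
                                                      (↓-expansion⁺ ℕP.≤-refl m<p iT)))
                      (Expansion-cong refl refl (cong (λ i → H (m ℕ.+ k) - H i) (ℕP.m+n∸n≡m m k))
                                      (↓-expansion⁺ (ℕP.m≤n+m k m) m+k<p iT))))
    reorder : ∀ P T F Y Z D → P * T * F * Y * Z * D ≡ D * (P * (T * (F * Y * Z)))
    reorder = solve-∀ ℚ-ring
    regroup : ∀ P T H₊ Hⱼ Hₘ → (1ℚ + P * T * H₊) - P * T * Hⱼ ≡ 1ℚ + P * T * ((- Hⱼ + (Hₘ - 0ℚ)) + (H₊ - Hₘ))
    regroup = solve-∀ ℚ-ring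

  binomProduct≡formula₃ : ∀ {m k T} → Integral T → m < k → m ℕ.+ k < p →
                          binomProduct k (ℕ→ℚ m + P * T) ≡ formula₃ m k T [p^ 3 ]
  binomProduct≡formula₃ {m} {T = T} iT m<k m+k<p =
    subst (λ k → binomProduct k (ℕ→ℚ m + P * T) ≡ formula₃ m k T [p^ 3 ]) (sym k≡m+1+j)
          (binomProduct≡formula₃-split m j iT (subst (λ k → m ℕ.+ k < p) k≡m+1+j m+k<p))
    where
    j = proj₁ (<⇒≡+suc m<k)
    k≡m+1+j = proj₂ (<⇒≡+suc m<k)

  [PT-1]↓j*[m+PT]↓m≡±j!*m! : ∀ m j {T} → Integral T → m ℕ.+ suc j < p →
    (P * T - 1ℚ) ↓ j * (ℕ→ℚ m + P * T) ↓ m ≡ negOnePow j * ℕ→ℚ (j !) * ℕ→ℚ (m !) [p^ 1 ]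
  [PT-1]↓j*[m+PT]↓m≡±j!*m! m j {T} iT m+1+j<p =
    subst (λ z → (P * T - 1ℚ) ↓ j * (ℕ→ℚ m + P * T) ↓ m ≡ negOnePow j * ℕ→ℚ (j !) * ℕ→ℚ z [p^ 1 ])
          (nP′n≡n! m)
          (≡[p^]-* (Expansion⇒≡[p] iT (↓-expansion⁻ j<p iT)) (Expansion⇒≡[p] iT (↓-expansion⁺ ℕP.≤-refl m<p iT))
                   (Integral-* (Integral-negOnePow j) (Integral-ℕ (j !))) (Integral-ℕ (m P′ m)))
    where
    m<p = ℕP.≤-<-trans (ℕP.m≤m+n m (suc j)) m+1+j<p
    j<p = ℕP.<-≤-trans (ℕP.n<1+n j) (ℕP.<⇒≤ (ℕP.≤-<-trans (ℕP.m≤n+m (suc j) m) m+1+j<p))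

  -- Both sides are ±(p-1)! j! c! D modulo p, by a!*b!≡±[a+b]! for (a, b) = (m, p-1-m) and (k-1, p-k).
  ±j!*m!*±j′!*c!*D≡±k!*k! : ∀ {h} c a j → p ≡ suc (h ℕ.+ h) → c ℕ.+ a ℕ.+ suc j ℕ.+ a ≡ p →
    let m = c ℕ.+ a; k = m ℕ.+ suc j; j′ = j ℕ.+ a in
    negOnePow j * ℕ→ℚ (j !) * ℕ→ℚ (m !) * (negOnePow j′ * ℕ→ℚ (j′ !) * ℕ→ℚ (c !))
      * ℕ→ℚ (k ℕ.* (k ∸ m) ℕ.* (m C a) ℕ.* (k C m))
    ≡ negOnePow m * ℕ→ℚ (k ! ℕ.* k !) [p^ 1 ]
  ±j!*m!*±j′!*c!*D≡±k!*k! {h} c a j p≡1+h+h p-split = begin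
    σⱼ * ℕ→ℚ (j !) * ℕ→ℚ (m !) * (σⱼ′ * ℕ→ℚ (j′ !) * ℕ→ℚ (c !)) * ℕ→ℚ Dₙ
      ≡⟨ reorder₁ σⱼ σⱼ′ (ℕ→ℚ (j !)) (ℕ→ℚ (m !)) (ℕ→ℚ (j′ !)) (ℕ→ℚ (c !)) (ℕ→ℚ Dₙ) ⟩
    σⱼ * σⱼ′ * (ℕ→ℚ (j !) * ℕ→ℚ (c !) * ℕ→ℚ Dₙ) * (ℕ→ℚ (m !) * ℕ→ℚ (j′ !))
      ≡⟨ cong₂ (λ u v → σⱼ * σⱼ′ * u * v) Q-cast (ℕ→ℚ-* (m !) (j′ !)) ⟨
    σⱼ * σⱼ′ * Q * ℕ→ℚ (m ! ℕ.* j′ !)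
      ∼⟨ ≡[p^]-*ˡ (σⱼ * σⱼ′ * Q) iσσQ (a!*b!≡±[a+b]! m+1+j′≡p) ⟩
    σⱼ * σⱼ′ * Q * (σₘ * ℕ→ℚ ((m ℕ.+ j′) !))
      ≡⟨ cong₂ (λ u v → u * Q * (σₘ * ℕ→ℚ (v !))) sign (sym (ℕP.+-assoc m j a)) ⟩
    σₘ₊ⱼ * Q * (σₘ * ℕ→ℚ ((m ℕ.+ j ℕ.+ a) !))
      ≡⟨ reorder₂ σₘ₊ⱼ Q σₘ (ℕ→ℚ ((m ℕ.+ j ℕ.+ a) !)) ⟩
    σₘ * Q * (σₘ₊ⱼ * ℕ→ℚ ((m ℕ.+ j ℕ.+ a) !))
      ∼⟨ ≡[p^]-*ˡ (σₘ * Q) iσQ (≡[p^]-sym (a!*b!≡±[a+b]! m+j+1+a≡p)) ⟩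
    σₘ * Q * ℕ→ℚ ((m ℕ.+ j) ! ℕ.* a !)
      ≡⟨ ℚP.*-assoc σₘ Q _ ⟩
    σₘ * (Q * ℕ→ℚ ((m ℕ.+ j) ! ℕ.* a !))
      ≡⟨ cong (σₘ *_) (ℕ→ℚ-*-≡ Qₙ _ (j!*c!*k*[k∸m]*mCa*kCm*[m+j]!*a!≡k!*k! c a j)) ⟩
    σₘ * ℕ→ℚ (k ! ℕ.* k !) ∎
    where
    open ≡[p^]-Reasoning 1
    m = c ℕ.+ a
    k = m ℕ.+ suc j
    j′ = j ℕ.+ a
    σⱼ = negOnePow j
    σⱼ′ = negOnePow j′
    σₘ = negOnePow m
    σₘ₊ⱼ = negOnePow (m ℕ.+ j)
    Dₙ = k ℕ.* (k ∸ m) ℕ.* (m C a) ℕ.* (k C m)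
    Qₙ = j ! ℕ.* c ! ℕ.* Dₙ
    Q = ℕ→ℚ Qₙ
    Q-cast : Q ≡ ℕ→ℚ (j !) * ℕ→ℚ (c !) * ℕ→ℚ Dₙ
    Q-cast = trans (ℕ→ℚ-* (j ! ℕ.* c !) Dₙ) (cong (_* ℕ→ℚ Dₙ) (ℕ→ℚ-* (j !) (c !)))
    iσσQ = Integral-* (Integral-* (Integral-negOnePow j) (Integral-negOnePow j′)) (Integral-ℕ Qₙ)
    iσQ = Integral-* (Integral-negOnePow m) (Integral-ℕ Qₙ)
    m+1+j′≡p : m ℕ.+ suc j′ ≡ p
    m+1+j′≡p = trans (rearrange c a j) p-split
      where
      rearrange : ∀ c a j → c ℕ.+ a ℕ.+ suc (j ℕ.+ a) ≡ c ℕ.+ a ℕ.+ suc j ℕ.+ a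
      rearrange = ℕSolver.solve-∀
    m+j+1+a≡p : m ℕ.+ j ℕ.+ suc a ≡ p
    m+j+1+a≡p = trans (rearrange c a j) p-split
      where
      rearrange : ∀ c a j → c ℕ.+ a ℕ.+ j ℕ.+ suc a ≡ c ℕ.+ a ℕ.+ suc j ℕ.+ a
      rearrange = ℕSolver.solve-∀
    sign : σⱼ * σⱼ′ ≡ σₘ₊ⱼ
    sign = negOnePow[j]*negOnePow[j+a]≡negOnePow[c+a+j] {h} c a j
             (ℕP.suc-injective (trans (sym (suc-out c a j)) (trans p-split p≡1+h+h)))
      where
      suc-out : ∀ c a j → c ℕ.+ a ℕ.+ suc j ℕ.+ a ≡ suc (c ℕ.+ a ℕ.+ j ℕ.+ a)
      suc-out = ℕSolver.solve-∀
    reorder₁ : ∀ σ σ′ jf mf j′f cf D → σ * jf * mf * (σ′ * j′f * cf) * D ≡ σ * σ′ * (jf * cf * D) * (mf * j′f)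
    reorder₁ = solve-∀ ℚ-ring
    reorder₂ : ∀ σ Q σ′ W → σ * Q * (σ′ * W) ≡ σ′ * Q * (σ * W)
    reorder₂ = solve-∀ ℚ-ring

  formula₂*k!*k!*D : ∀ m k T → let D = ℕ→ℚ k * ℕ→ℚ (k ∸ m) * ℕ→ℚ (m C (p ∸ k)) * ℕ→ℚ (k C m) in D ≢ 0ℚ →
    formula₂ m k T * ℕ→ℚ (k ! ℕ.* k !) * D ≡ P * (P * (T * (T + 1ℚ) * (negOnePow m * ℕ→ℚ (k ! ℕ.* k !))))
  formula₂*k!*k!*D m k T D≢0 = begin
    (a ÷' D) * KK * D     ≡⟨ reorder₁ (a ÷' D) KK D ⟩
    (a ÷' D) * D * KK     ≡⟨ cong (_* KK) (÷'-*-cancel a D≢0) ⟩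
    a * KK                ≡⟨ reorder₂ (negOnePow m) P T KK ⟩
    P * (P * (T * (T + 1ℚ) * (negOnePow m * KK)))   ∎
    where
    open ≡-Reasoning
    D = ℕ→ℚ k * ℕ→ℚ (k ∸ m) * ℕ→ℚ (m C (p ∸ k)) * ℕ→ℚ (k C m)
    KK = ℕ→ℚ (k ! ℕ.* k !)
    a = negOnePow m * (P * P) * T * (T + 1ℚ)
    reorder₁ : ∀ q K D → q * K * D ≡ q * D * K
    reorder₁ = solve-∀ ℚ-ring
    reorder₂ : ∀ σ P T K → σ * (P * P) * T * (T + 1ℚ) * K ≡ P * (P * (T * (T + 1ℚ) * (σ * K)))
    reorder₂ = solve-∀ ℚ-ring

  -- For p - m ≤ k < p: a = p - k, c = m + k - p and j = k - m - 1.
  record HighRangeSplit (m k : ℕ) : Set where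
    field
      c a j         : ℕ
      0<a           : 0 < a
      c+a≡m         : c ℕ.+ a ≡ m
      c+a+1+j≡k     : c ℕ.+ a ℕ.+ suc j ≡ k
      c+a+1+j+a≡p   : c ℕ.+ a ℕ.+ suc j ℕ.+ a ≡ p

  high-range-split : ∀ {m k} → m ℕ.+ m < p → p ≤ m ℕ.+ k → k < p → HighRangeSplit m k
  high-range-split {m} {k} 2m<p p≤m+k k<p with ℕP.m≤n⇒∃[o]m+o≡n (ℕP.<⇒≤ k<p)
  ... | zero , k+0≡p = ⊥-elim (ℕP.<⇒≢ k<p (trans (sym (ℕP.+-identityʳ k)) k+0≡p))
  ... | a@(suc _) , k+a≡p
    with ℕP.m≤n⇒∃[o]m+o≡n (ℕP.+-cancelˡ-≤ k a m (subst₂ _≤_ (sym k+a≡p) (ℕP.+-comm m k) p≤m+k))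
  ... | c , a+c≡m with <⇒≡+suc (ℕP.+-cancelˡ-< m m k (ℕP.<-≤-trans 2m<p p≤m+k))
  ... | j , refl with trans (ℕP.+-comm c a) a+c≡m
  ... | refl = record { c = c ; a = a ; j = j ; 0<a = s≤s z≤n ; c+a≡m = refl ; c+a+1+j≡k = refl ; c+a+1+j+a≡p = k+a≡p }

  [m+k+PT]↓k-split : ∀ c a j T → c ℕ.+ a ℕ.+ suc j ℕ.+ a ≡ p →
    let m = c ℕ.+ a; k = m ℕ.+ suc j; T′ = T + 1ℚ in
    (ℕ→ℚ (m ℕ.+ k) + P * T) ↓ k ≡ P * T′ * (P * T′ - 1ℚ) ↓ (j ℕ.+ a) * (ℕ→ℚ c + P * T′) ↓ c
  [m+k+PT]↓k-split c a j T p-split =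
    trans (cong₂ _↓_ m+k+PT≡c+PT′ (k≡c+1+j′ c a j)) (↓-split c (j ℕ.+ a) (P * (T + 1ℚ)))
    where
    m+k≡c+p : ∀ c a j → c ℕ.+ a ℕ.+ (c ℕ.+ a ℕ.+ suc j) ≡ c ℕ.+ (c ℕ.+ a ℕ.+ suc j ℕ.+ a)
    m+k≡c+p = ℕSolver.solve-∀
    k≡c+1+j′ : ∀ c a j → c ℕ.+ a ℕ.+ suc j ≡ c ℕ.+ suc (j ℕ.+ a)
    k≡c+1+j′ = ℕSolver.solve-∀
    distrib : ∀ c P T → c + P + P * T ≡ c + P * (T + 1ℚ)
    distrib = solve-∀ ℚ-ring
    m+k+PT≡c+PT′ : ℕ→ℚ (c ℕ.+ a ℕ.+ (c ℕ.+ a ℕ.+ suc j)) + P * T ≡ ℕ→ℚ c + P * (T + 1ℚ)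
    m+k+PT≡c+PT′ = begin
      ℕ→ℚ (c ℕ.+ a ℕ.+ (c ℕ.+ a ℕ.+ suc j)) + P * T  ≡⟨ cong (λ i → ℕ→ℚ i + P * T) (trans (m+k≡c+p c a j) (cong (c ℕ.+_) p-split)) ⟩
      ℕ→ℚ (c ℕ.+ p) + P * T                          ≡⟨ cong (_+ P * T) (ℕ→ℚ-+ c p) ⟩
      ℕ→ℚ c + P + P * T                              ≡⟨ distrib (ℕ→ℚ c) P T ⟩
      ℕ→ℚ c + P * (T + 1ℚ)                           ∎
      where open ≡-Reasoning

  binomProduct≡formula₂-split : ∀ {h T} c a j → p ≡ suc (h ℕ.+ h) → Integral T → 0 < a →
    c ℕ.+ a ℕ.+ suc j ℕ.+ a ≡ p →
    binomProduct (c ℕ.+ a ℕ.+ suc j) (ℕ→ℚ (c ℕ.+ a) + P * T) ≡ formula₂ (c ℕ.+ a) (c ℕ.+ a ℕ.+ suc j) T [p^ 3 ]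
  binomProduct≡formula₂-split {h} {T} c a@(suc a′) j p≡1+h+h iT _ p-split =
    ≡[p^]-cancelʳ (p∤k!*k! k<p) (≡[p^]-cancelʳ p∤Dₙ (begin
      binomProduct k y * KK * D                    ≡⟨ cong (_* D) (binomProduct*k!*k!-split m j (P * T)) ⟩
      P * T * F * Y * Z * D                        ≡⟨ cong (λ z → P * T * F * Y * z * D) ([m+k+PT]↓k-split c a j T p-split) ⟩
      P * T * F * Y * (P * T′ * G * W) * D         ≡⟨ reorder P T T′ F Y G W D ⟩
      D * (P * (P * (T * T′ * (F * Y * (G * W))))) ∼⟨ ≡[p^]-*ˡ D (Integral-ℕ Dₙ) (≡[p^]-P* (≡[p^]-P* (≡[p^]-*ˡ (T * T′) iTT′ FYGW≡A))) ⟩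
      D * (P * (P * (T * T′ * A)))                 ≡⟨ move-D D P (T * T′) A ⟩
      P * (P * (T * T′ * (A * D)))                 ∼⟨ ≡[p^]-P* (≡[p^]-P* (≡[p^]-*ˡ (T * T′) iTT′ A*D≡σₘ*KK)) ⟩
      P * (P * (T * T′ * (σₘ * KK)))               ≡⟨ formula₂*k!*k!*D m k T D′≢0 ⟨
      formula₂ m k T * KK * D′                     ≡⟨ cong (formula₂ m k T * KK *_) D≡D′ ⟨
      formula₂ m k T * KK * D                      ∎))
    where
    open ≡[p^]-Reasoning 3
    m = c ℕ.+ a
    k = m ℕ.+ suc j
    j′ = j ℕ.+ a
    y = ℕ→ℚ m + P * T
    T′ = T + 1ℚ
    iTT′ = Integral-* iT (Integral-+ iT (Integral-ℕ 1))
    F = (P * T - 1ℚ) ↓ j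
    Y = y ↓ m
    Z = (ℕ→ℚ (m ℕ.+ k) + P * T) ↓ k
    G = (P * T′ - 1ℚ) ↓ j′
    W = (ℕ→ℚ c + P * T′) ↓ c
    σₘ = negOnePow m
    KK = ℕ→ℚ (k ! ℕ.* k !)
    Dₙ = k ℕ.* (k ∸ m) ℕ.* (m C a) ℕ.* (k C m)
    D = ℕ→ℚ Dₙ
    D′ = ℕ→ℚ k * ℕ→ℚ (k ∸ m) * ℕ→ℚ (m C (p ∸ k)) * ℕ→ℚ (k C m)
    A = negOnePow j * ℕ→ℚ (j !) * ℕ→ℚ (m !) * (negOnePow j′ * ℕ→ℚ (j′ !) * ℕ→ℚ (c !))
    k<p : k < p
    k<p = +suc≡p⇒<p a′ p-split
    1+j≤k = ℕP.m≤n+m (suc j) m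
    p∤Dₙ : ¬ p ∣ Dₙ
    p∤Dₙ = p∤* (p∤* (p∤* (p∤-< (ℕP.<-≤-trans (s≤s z≤n) 1+j≤k) k<p)
                          (subst (λ i → ¬ p ∣ i) (sym (ℕP.m+n∸m≡n m (suc j))) (p∤-< (s≤s z≤n) (ℕP.≤-<-trans 1+j≤k k<p))))
                     (p∤C (ℕP.m≤n+m a c) (ℕP.≤-<-trans (ℕP.m≤m+n m (suc j)) k<p)))
               (p∤C (ℕP.m≤m+n m (suc j)) k<p)
    D≡D′ : D ≡ D′
    D≡D′ = begin-equality
      ℕ→ℚ (k ℕ.* (k ∸ m) ℕ.* (m C a) ℕ.* (k C m))         ≡⟨ ℕ→ℚ-* (k ℕ.* (k ∸ m) ℕ.* (m C a)) (k C m) ⟩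
      ℕ→ℚ (k ℕ.* (k ∸ m) ℕ.* (m C a)) * ℕ→ℚ (k C m)       ≡⟨ cong (_* ℕ→ℚ (k C m)) (ℕ→ℚ-* (k ℕ.* (k ∸ m)) (m C a)) ⟩
      ℕ→ℚ (k ℕ.* (k ∸ m)) * ℕ→ℚ (m C a) * ℕ→ℚ (k C m)     ≡⟨ cong (λ z → z * ℕ→ℚ (m C a) * ℕ→ℚ (k C m)) (ℕ→ℚ-* k (k ∸ m)) ⟩
      ℕ→ℚ k * ℕ→ℚ (k ∸ m) * ℕ→ℚ (m C a) * ℕ→ℚ (k C m)     ≡⟨ cong (λ i → ℕ→ℚ k * ℕ→ℚ (k ∸ m) * ℕ→ℚ (m C i) * ℕ→ℚ (k C m)) p∸k≡a ⟨
      D′                                                    ∎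
      where
      p∸k≡a : p ∸ k ≡ a
      p∸k≡a = trans (cong (_∸ k) (sym p-split)) (ℕP.m+n∸m≡n k a)
    D′≢0 : D′ ≢ 0ℚ
    D′≢0 = subst (_≢ 0ℚ) D≡D′ (ℕ→ℚ-≢0 (p∤0 p∤Dₙ))
    k≡c+1+j′ : k ≡ c ℕ.+ suc j′
    k≡c+1+j′ = rearrange c a j
      where
      rearrange : ∀ c a j → c ℕ.+ a ℕ.+ suc j ≡ c ℕ.+ suc (j ℕ.+ a)
      rearrange = ℕSolver.solve-∀
    FYGW≡A : F * Y * (G * W) ≡ A [p^ 1 ]
    FYGW≡A = ≡[p^]-* ([PT-1]↓j*[m+PT]↓m≡±j!*m! m j iT k<p)
                     ([PT-1]↓j*[m+PT]↓m≡±j!*m! c j′ (Integral-+ iT (Integral-ℕ 1)) (subst (_< p) k≡c+1+j′ k<p))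
                     (Integral-±!*! j m) (Integral-±!*! j′ c)
      where
      Integral-±!*! : ∀ i n → Integral (negOnePow i * ℕ→ℚ (i !) * ℕ→ℚ (n !))
      Integral-±!*! i n = Integral-* (Integral-* (Integral-negOnePow i) (Integral-ℕ (i !))) (Integral-ℕ (n !))
    A*D≡σₘ*KK : A * D ≡ σₘ * KK [p^ 1 ]
    A*D≡σₘ*KK = ±j!*m!*±j′!*c!*D≡±k!*k! {h} c a j p≡1+h+h p-split
    reorder : ∀ P T T′ F Y G W D → P * T * F * Y * (P * T′ * G * W) * D ≡ D * (P * (P * (T * T′ * (F * Y * (G * W)))))
    reorder = solve-∀ ℚ-ring
    move-D : ∀ D P U A → D * (P * (P * (U * A))) ≡ P * (P * (U * (A * D)))
    move-D = solve-∀ ℚ-ring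

  binomProduct≡formula₂ : ∀ {h m k T} → p ≡ suc (h ℕ.+ h) → Integral T → m ℕ.+ m < p → p ≤ m ℕ.+ k → k < p →
                          binomProduct k (ℕ→ℚ m + P * T) ≡ formula₂ m k T [p^ 3 ]
  binomProduct≡formula₂ {h} {m} {k} {T} p≡1+h+h iT 2m<p p≤m+k k<p =
    subst₂ (λ m k → binomProduct k (ℕ→ℚ m + P * T) ≡ formula₂ m k T [p^ 3 ]) c+a≡m c+a+1+j≡k
           (binomProduct≡formula₂-split {h} c a j p≡1+h+h iT 0<a c+a+1+j+a≡p)
    where open HighRangeSplit (high-range-split {m} {k} 2m<p p≤m+k k<p)

  p^∣⇒fraction : ∀ {r c} → p^ r ∣ c →
                 Σ ℤ λ w → Σ ℕ λ v → ¬ p ∣ v × c * ℕ→ℚ v ≡ ℤ→ℚ (+ (p ^ r) ℤ.* w)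
  p^∣⇒fraction {zero}  (integral u v p∤v cv≡u) = u , v , p∤v , trans cv≡u (cong ℤ→ℚ (sym (ℤP.*-identityˡ u)))
  p^∣⇒fraction {suc r} (b , p^r∣b , refl) with p^∣⇒fraction p^r∣b
  ... | w , v , p∤v , bv≡p^rw = w , v , p∤v , (begin
      P * b * ℕ→ℚ v                         ≡⟨ ℚP.*-assoc P b (ℕ→ℚ v) ⟩
      P * (b * ℕ→ℚ v)                       ≡⟨ cong (P *_) bv≡p^rw ⟩
      ℤ→ℚ (+ p) * ℤ→ℚ (+ (p ^ r) ℤ.* w)     ≡⟨ ℤ→ℚ-* (+ p) _ ⟨
      ℤ→ℚ (+ p ℤ.* (+ (p ^ r) ℤ.* w))       ≡⟨ cong ℤ→ℚ (ℤP.*-assoc (+ p) (+ (p ^ r)) w) ⟨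
      ℤ→ℚ (+ p ℤ.* + (p ^ r) ℤ.* w)         ≡⟨ cong (λ z → ℤ→ℚ (z ℤ.* w)) (ℤP.pos-* p (p ^ r)) ⟨
      ℤ→ℚ (+ (p ^ suc r) ℤ.* w)             ∎)
    where open ≡-Reasoning

  p^r∣x*v⇒p^r∣x : ∀ r {x v} → ¬ p ∣ v → p ^ r ∣ x ℕ.* v → p ^ r ∣ x
  p^r∣x*v⇒p^r∣x zero    {x}     p∤v _ = ℕD.1∣ x
  p^r∣x*v⇒p^r∣x (suc r) {x} {v} p∤v p^r+1∣xv
    with euclidsLemma x v p-prime (ℕD.∣-trans (ℕD.m∣m*n (p ^ r)) p^r+1∣xv)
  ... | inj₂ p∣v = ⊥-elim (p∤v p∣v)
  ... | inj₁ (divides x′ refl) =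
    subst (p ^ suc r ∣_) (ℕP.*-comm p x′)
          (ℕD.*-monoʳ-∣ p (p^r∣x*v⇒p^r∣x r p∤v (ℕD.*-cancelˡ-∣ p {{prime⇒nonZero p-prime}} p^r+1∣pxv)))
    where
    p^r+1∣pxv : p ℕ.* (p ^ r) ∣ p ℕ.* (x′ ℕ.* v)
    p^r+1∣pxv = subst (p ℕ.* (p ^ r) ∣_) (trans (cong (ℕ._* v) (ℕP.*-comm x′ p)) (ℕP.*-assoc p x′ v)) p^r+1∣xv

  fraction⇒p^r∣↥∧p∤↧ : ∀ r c w {v} → ¬ p ∣ v → c * ℕ→ℚ v ≡ ℤ→ℚ (+ (p ^ r) ℤ.* w) →
                        p ^ r ∣ ℤ.∣ ↥ c ∣ × ¬ p ∣ ↧ₙ c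
  fraction⇒p^r∣↥∧p∤↧ r (mkℚ n d-1 coprime) w {v} p∤v cv≡W = p^r∣n , p∤d
    where
    W = + (p ^ r) ℤ.* w
    cross : (n ℤ.* + v) ℤ.* + 1 ≡ W ℤ.* + suc (d-1 ℕ.* 1)
    cross with ℚP./-injective-≃ (ℚᵘ.mkℚᵘ (n ℤ.* + v) (d-1 ℕ.* 1)) (ℚᵘ.mkℚᵘ W 0)
                 (trans (cong (mkℚ n d-1 coprime *_) (sym (ℤ→ℚ≡mkℚ (+ v)))) cv≡W)
    ... | ℚᵘ.*≡* eq = eq
    ∣n∣v≡p^r∣w∣d : ℤ.∣ n ∣ ℕ.* v ≡ p ^ r ℕ.* ℤ.∣ w ∣ ℕ.* suc d-1
    ∣n∣v≡p^r∣w∣d = begin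
      ℤ.∣ n ∣ ℕ.* v                     ≡⟨ ℤP.abs-* n (+ v) ⟨
      ℤ.∣ n ℤ.* + v ∣                   ≡⟨ cong ℤ.∣_∣ (ℤP.*-identityʳ (n ℤ.* + v)) ⟨
      ℤ.∣ (n ℤ.* + v) ℤ.* + 1 ∣         ≡⟨ cong ℤ.∣_∣ cross ⟩
      ℤ.∣ W ℤ.* + suc (d-1 ℕ.* 1) ∣     ≡⟨ ℤP.abs-* W _ ⟩
      ℤ.∣ W ∣ ℕ.* suc (d-1 ℕ.* 1)       ≡⟨ cong₂ ℕ._*_ (ℤP.abs-* (+ (p ^ r)) w) (cong suc (ℕP.*-identityʳ d-1)) ⟩
      p ^ r ℕ.* ℤ.∣ w ∣ ℕ.* suc d-1     ∎
      where open ≡-Reasoning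
    p^r∣n : p ^ r ∣ ℤ.∣ n ∣
    p^r∣n = p^r∣x*v⇒p^r∣x r p∤v
              (subst (p ^ r ∣_) (sym ∣n∣v≡p^r∣w∣d)
                     (subst (p ^ r ∣_) (sym (ℕP.*-assoc (p ^ r) ℤ.∣ w ∣ (suc d-1))) (ℕD.m∣m*n _)))
    p∤d : ¬ p ∣ suc d-1
    p∤d p∣d with euclidsLemma ℤ.∣ n ∣ v p-prime
                   (subst (p ∣_) (sym ∣n∣v≡p^r∣w∣d) (ℕD.∣n⇒∣m*n (p ^ r ℕ.* ℤ.∣ w ∣) p∣d))
    ... | inj₂ p∣v = p∤v p∣v
    ... | inj₁ p∣n = p∤1 (subst (p ∣_) (Coprime.recompute coprime (p∣n , p∣d)) ℕD.∣-refl)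

  ≡[p^]⇒QCong : ∀ {r a b} → a ≡ b [p^ r ] → QCong p r a b
  ≡[p^]⇒QCong {r} {a} {b} (≡[p^]-by a≡b) with p^∣⇒fraction a≡b
  ... | w , v , p∤v , eq = fraction⇒p^r∣↥∧p∤↧ r (a - b) w p∤v eq

  PCong-intro : ∀ {r m} (x : ℤₚ p) (F G : ℚ → ℚ) →
    (∀ n → Σ ℤ λ t → approx x (suc n) ≡ + m ℤ.+ + p ℤ.* t) →
    (∀ {T} → Integral T → F (ℕ→ℚ m + P * T) ≡ G T [p^ r ]) →
    PCong x r F (λ y → G ((y - ℕ→ℚ m) ÷' P))
  PCong-intro {r} {m} x F G residue-class F≡G = 1 , λ { zero () ; (suc n) _ → ≡[p^]⇒QCong (congruence n) }
    where
    t : ℕ → ℤ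
    t n = proj₁ (residue-class n)
    y≡m+Pt : ∀ n → ℤ→ℚ (approx x (suc n)) ≡ ℕ→ℚ m + P * ℤ→ℚ (t n)
    y≡m+Pt n = trans (cong ℤ→ℚ (proj₂ (residue-class n)))
                     (trans (ℤ→ℚ-+ (+ m) (+ p ℤ.* t n)) (cong (λ u → ℕ→ℚ m + u) (ℤ→ℚ-* (+ p) (t n))))
    cancel : ∀ m u → m + u - m ≡ u
    cancel = solve-∀ ℚ-ring
    t≡ : ∀ z → (ℕ→ℚ m + P * ℤ→ℚ z - ℕ→ℚ m) ÷' P ≡ ℤ→ℚ z
    t≡ z = trans (cong (_÷' P) (cancel (ℕ→ℚ m) (P * ℤ→ℚ z))) (*-÷'-cancel (ℤ→ℚ z) (ℕ→ℚ-≢0 (ℕ.≢-nonZero⁻¹ p {{prime⇒nonZero p-prime}})))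
    congruence : ∀ n → F (ℤ→ℚ (approx x (suc n))) ≡ G ((ℤ→ℚ (approx x (suc n)) - ℕ→ℚ m) ÷' P) [p^ r ]
    congruence n = subst (λ y → F y ≡ G ((y - ℕ→ℚ m) ÷' P) [p^ r ]) (sym (y≡m+Pt n))
                         (subst (λ T → F (ℕ→ℚ m + P * ℤ→ℚ (t n)) ≡ G T [p^ r ]) (sym (t≡ (t n)))
                                (F≡G (Integral-ℤ (t n))))

approx≡resid+p* : ∀ {q} (x : ℤₚ (suc q)) n → Σ ℤ λ t → approx x (suc n) ≡ + resid x ℤ.+ + suc q ℤ.* t
approx≡resid+p* {q} x zero = approx x 1 ℤ./ℕ suc q ,
  trans (ℤDivMod.a≡a%ℕn+[a/ℕn]*n (approx x 1) (suc q)) (cong (λ u → + resid x ℤ.+ u) (ℤP.*-comm (approx x 1 ℤ./ℕ suc q) (+ suc q)))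
approx≡resid+p* {q} x (suc n) with approx≡resid+p* x n
... | t , approxₙ≡ with ℤDivisibility.∣ᵤ⇒∣ {+ suc q} {approx x (suc (suc n)) ℤ.- approx x (suc n)} (ℕD.∣-trans (ℕD.m∣m*n (suc q ^ n)) (coh x (suc n)))
... | ℤDivisibility.divides d diff≡ = t ℤ.+ d , (begin
  approx x (suc (suc n))                                   ≡⟨ split (approx x (suc (suc n))) (approx x (suc n)) ⟩
  (approx x (suc (suc n)) ℤ.- approx x (suc n)) ℤ.+ approx x (suc n)   ≡⟨ cong₂ ℤ._+_ diff≡ approxₙ≡ ⟩
  d ℤ.* + suc q ℤ.+ (+ resid x ℤ.+ + suc q ℤ.* t)          ≡⟨ regroup d (+ suc q) (+ resid x) t ⟩
  + resid x ℤ.+ + suc q ℤ.* (t ℤ.+ d)                      ∎)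
  where
  open ≡-Reasoning
  split : ∀ a b → a ≡ (a ℤ.- b) ℤ.+ b
  split = ℤSolver.solve-∀
  regroup : ∀ d p m t → d ℤ.* p ℤ.+ (m ℤ.+ p ℤ.* t) ≡ m ℤ.+ p ℤ.* (t ℤ.+ d)
  regroup = ℤSolver.solve-∀

lemma2p1 : (p : ℕ) → Prime p → p ≢ 2 → (x : ℤₚ p) →
  let m = resid x
      t = λ (y : ℚ) → (y ℚ.- ℕ→ℚ m) ÷' ℕ→ℚ p
      P = ℕ→ℚ p
      LHS = λ (k : ℕ) (y : ℚ) → binomQ y k ℚ.* binomQ (y ℚ.+ ℕ→ℚ k) k
  in m ≤ (p ∸ 1) ℕ./ 2 →
     (∀ (k : ℕ) → k ≤ m →
        PCong x 2 (LHS k)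
          (λ y → ℕ→ℚ (m C k) ℚ.* ℕ→ℚ ((m ℕ.+ k) C k)
                 ℚ.* ((1ℚ ℚ.+ P ℚ.* t y ℚ.* H (m ℕ.+ k)) ℚ.- P ℚ.* t y ℚ.* H (m ∸ k))))
   × (∀ (k : ℕ) → p ∸ m ≤ k → k ≤ p ∸ 1 →
        PCong x 3 (LHS k)
          (λ y → (negOnePow m ℚ.* (P ℚ.* P) ℚ.* t y ℚ.* (t y ℚ.+ 1ℚ))
                 ÷' (ℕ→ℚ k ℚ.* ℕ→ℚ (k ∸ m) ℚ.* ℕ→ℚ (m C (p ∸ k)) ℚ.* ℕ→ℚ (k C m))))
   × (m < (p ∸ 1) ℕ./ 2 → ∀ (k : ℕ) → m ℕ.+ 1 ≤ k → k ≤ p ∸ 1 ∸ m →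
        PCong x 3 (LHS k)
          (λ y → ((negOnePow (m ℕ.+ k ℕ.+ 1) ℚ.* P ℚ.* t y ℚ.* ℕ→ℚ ((m ℕ.+ k) C k))
                  ÷' (ℕ→ℚ (k ∸ m) ℚ.* ℕ→ℚ (k C m)))
                 ℚ.* ((1ℚ ℚ.+ P ℚ.* t y ℚ.* H (m ℕ.+ k)) ℚ.- P ℚ.* t y ℚ.* H (k ∸ m ∸ 1))))
lemma2p1 zero    p-prime _ _ _ = ⊥-elim (ℕ.≢-nonZero⁻¹ 0 {{prime⇒nonZero p-prime}} refl)
lemma2p1 (suc q) p-prime p≢2 x m≤q/2 =
    (λ k k≤m → PCong-intro x (binomProduct k) (formula₁ m k) residue-class
                 (λ iT → binomProduct≡formula₁ iT k≤m (ℕP.≤-<-trans (ℕP.+-monoʳ-≤ m k≤m) m+m<p)))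
  , (λ k p∸m≤k k≤q → PCong-intro x (binomProduct k) (formula₂ m k) residue-class
                 (λ iT → binomProduct≡formula₂ {h} p≡1+h+h iT m+m<p
                           (ℕP.≤-trans (ℕP.m≤n+m∸n (suc q) m) (ℕP.+-monoʳ-≤ m p∸m≤k)) (s≤s k≤q)))
  -- m < (p-1)/2 only serves to make the range of k nonempty.
  , (λ _ k m+1≤k k≤q∸m → PCong-intro x (binomProduct k) (formula₃ m k) residue-class
                 (λ iT → binomProduct≡formula₃ iT (subst (_≤ k) (ℕP.+-comm m 1) m+1≤k)
                           (s≤s (subst (_≤ q) (ℕP.+-comm k m) (ℕP.m≤o∸n⇒m+n≤o k m≤q k≤q∸m)))))
  where
  open Integrality p-prime
  m = resid x
  residue-class = approx≡resid+p* x
  h = proj₁ (p≢2⇒odd p≢2)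
  p≡1+h+h = proj₂ (p≢2⇒odd p≢2)
  m+m≤q : m ℕ.+ m ≤ q
  m+m≤q = ℕP.≤-trans (ℕP.+-mono-≤ m≤q/2 m≤q/2) (subst (_≤ q) (double (q ℕ./ 2)) (m/n*n≤m q 2))
    where
    double : ∀ n → n ℕ.* 2 ≡ n ℕ.+ n
    double = ℕSolver.solve-∀
  m+m<p : m ℕ.+ m < suc q
  m+m<p = s≤s m+m≤q
  m≤q : m ≤ q
  m≤q = ℕP.≤-trans (ℕP.m≤m+n m m) m+m≤q
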